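{- For every Boolean function $F$, $$\mathsf{fiw}(F)\le \mathsf{fw}(F)^2\le 2^{(\mathsf{ctw}(F)+2)\,2^{\mathsf{ctw}(F)+2}}.$$
   Context: Boolean functions: $F\colon\{0,1\}^X\to\{0,1\}$, $\mathsf{sat}(F)=F^{ -1}(1)$. For $Y$ a set of variables and $b\colon Y\cap X\to\{0,1\}$, the cofactor $F(b,X\setminus Y)$ is $b'\mapsto F(b\cup b')$ on $\{0,1\}^{X\setminus Y}$. A function $G$ on $\{0,1\}^{Y\cap X}$ is a factor of $F$ relative to $Y$ if for some cofactor $F'$ of $F$ induced by an assignment of $Y\cap X$, $G(b)=1$ iff $F(b,X\setminus Y)=F'$; $\mathsf{factors}(F,Y)$ is the set of factors. For disjoint $Y,Y'\subseteq X$ and $H\in\mathsf{factors}(F,Y\cup Y')$, $\mathsf{impl}(F,H,Y,Y')$ is the set of pairs $(G,G')\in\mathsf{factors}(F,Y)\times\mathsf{factors}(F,Y')$ with $\mathsf{sat}(G)\times\mathsf{sat}(G')\subseteq\mathsf{sat}(H)$. A vtree for a set $Z$ is a rooted ordered binary tree with leaves in bijection with $Z$; $Z_v$ is the set of leaves below node $v$. Factor width: for a vtree $T$ for $Z\supseteq X$, $\mathsf{fw}(F,T)=\max_{v\in T}|\mathsf{factors}(F,Z_v)|$, $\mathsf{fw}(F)=\min_T\mathsf{fw}(F,T)$. Circuits over $X$: DAGs with input gates labelled by distinct variables or constants, internal unbounded-fanin $\wedge$, $\vee$ and fanin-1 $\neg$ gates and an output gate; $\mathsf{var}(C_g)$ denotes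 the variables of the subcircuit at $g$. $\mathsf{ctw}(F)$ is the minimum treewidth of the undirected graph underlying a circuit computing $F$. A fanin-2 $\wedge$-gate with inputs $h,h'$ is structured by node $v$ of a vtree with children $v_l,v_r$ if $\mathsf{var}(C_h)\subseteq X_{v_l}$, $\mathsf{var}(C_{h'})\subseteq X_{v_r}$. Construction (for $T$ a vtree for $X$ whose non-leaf nodes have two children): for $v\in T$, $H\in\mathsf{factors}(F,X_v)$: if $v$ is a leaf $x$ and $F(0,X\setminus\{x\})=F(1,X\setminus\{x\})$, then $\mathsf{factors}(F,\{x\})=\{H\}$ and $C_{v,H}=\top$; otherwise $\mathsf{factors}(F,\{x\})=\{H_0,H_1\}$ with $\mathsf{sat}(H_c)=\{x\mapsto c\}$, $C_{v,H_0}=\neg x$, $C_{v,H_1}=x$. If $v$ has children $w,w'$: $C_{v,H}=\bigvee_{(G,G')\in\mathsf{impl}(F,H,X_w,X_{w'})}(C_{w,G}\wedge C_{w',G'})$ (subcircuits for the same $(w,G)$ shared). $C_{F,T}=C_{r,F}$ for the root $r$. $\mathsf{fiw}(F,T)$ is the maximum over $v\in T$ of the number of $\wedge$-gates of $C_{F,T}$ structured by $v$, and $\mathsf{fiw}(F)=\min_T\mathsf{fiw}(F,T)$ over vtrees $T$ for $X$.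
   Formalization: An ∧-gate of $C_{F,T}$ is structured by v when it is one of the gates $C_{w,G}$ ∧ $C_{w',G'}$ built at v from its children w, w′ and reachable from $C_{r,F}$, in place of $\mathsf{var}(C_h)\subseteq X_{v_l}$ and $\mathsf{var}(C_{h'})\subseteq X_{v_r}$. The paper assumes this as well. -}

module Defs where

open import Data.Bool using (Bool; true; false; _∧_; _∨_; not; if_then_else_)
open import Data.Nat using (ℕ; zero; suc; _⊔_; _≤_; _+_)
open import Data.Fin using (Fin; zero; suc)
open import Data.Fin.Subset using (Subset; ∣_∣) renaming (_∈_ to _∈ₛ_)
open import Data.List using (List; []; _∷_; _++_; map; length; concatMap;
  cartesianProduct; filterᵇ; deduplicate)
open import Data.Bool.ListAction using (all; any; and; or)
open import Data.List.Membership.Propositional using (_∈_)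
open import Data.List.Relation.Unary.Unique.Propositional using (Unique)
open import Data.Maybe using (Maybe; just; nothing)
open import Data.Product using (Σ; Σ-syntax; ∃; ∃-syntax; _×_; _,_; proj₁; proj₂)
open import Data.Sum using (_⊎_; inj₁; inj₂)
open import Data.Vec using (Vec; []; _∷_; lookup)
open import Relation.Binary.PropositionalEquality using (_≡_)
open import Relation.Binary.Definitions using (DecidableEquality)
open import Relation.Nullary.Decidable using (⌊_⌋)
import Data.Bool.Properties as BoolP
import Data.List.Properties as ListP
import Data.Fin.Properties as FinP
import Data.Sum.Properties as SumP

Assign : ℕ → Set
Assign n = Fin n → Bool

BF : ℕ → Set
BF n = Assign n → Bool

allAssign : (n : ℕ) → List (Assign n)
allAssign zero = (λ ()) ∷ []
allAssign (suc n) = concatMap (λ a → ext false a ∷ ext true a ∷ []) (allAssign n)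
  where
  ext : Bool → Assign n → Assign (suc n)
  ext c a zero = c
  ext c a (suc i) = a i

table : ∀ {n} → BF n → List Bool
table {n} f = map f (allAssign n)

-- A subset Y ∩ X of X is given by its characteristic function.
-- A function on {0,1}^{Y∩X} is represented by a BF n which only looks at
-- the coordinates in Y ∩ X (all functions below are of this form).
-- merge S b a : takes the values of b on S and of a outside S (b ∪ a).
merge : ∀ {n} → (Fin n → Bool) → Assign n → Assign n → Assign n
merge S b a x = if S x then b x else a x

cofactor : ∀ {n} → BF n → (Fin n → Bool) → Assign n → BF n
cofactor F S b a = F (merge S b a)

-- Two functions are equal iff their truth tables are (decidable).
SameFn : ∀ {n} → BF n → BF n → Set
SameFn f g = table f ≡ table g

sameFn? : ∀ {n} (f g : BF n) → Relation.Nullary.Decidable.Dec (SameFn f g)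
sameFn? f g = ListP.≡-dec BoolP._≟_ (table f) (table g)

factorOf : ∀ {n} → BF n → (Fin n → Bool) → Assign n → BF n
factorOf F S b₀ b = ⌊ sameFn? (cofactor F S b) (cofactor F S b₀) ⌋

factors : ∀ {n} → BF n → (Fin n → Bool) → List (BF n)
factors {n} F S = deduplicate sameFn? (map (factorOf F S) (allAssign n))

implies : ∀ {n} → (Fin n → Bool) → BF n → BF n → BF n → Bool
implies {n} S G G' H =
  all (λ b → all (λ b' → not (G b ∧ G' b') ∨ H (merge S b b')) (allAssign n)) (allAssign n)

impl : ∀ {n} → BF n → BF n → (Fin n → Bool) → (Fin n → Bool) → List (BF n × BF n)
impl F H S S' =
  filterᵇ (λ p → implies S (proj₁ p) (proj₂ p) H) (cartesianProduct (factors F S) (factors F S'))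

data VTree (Z : Set) : Set where
  leaf : Z → VTree Z
  un   : VTree Z → VTree Z
  bin  : VTree Z → VTree Z → VTree Z

leaves : ∀ {Z} → VTree Z → List Z
leaves (leaf z) = z ∷ []
leaves (un t) = leaves t
leaves (bin l r) = leaves l ++ leaves r

IsVTreeFor : ∀ {Z} → VTree Z → Set
IsVTreeFor {Z} T = Unique (leaves T) × ((z : Z) → z ∈ leaves T)

Full : ∀ {Z} → VTree Z → Set
Full (leaf z) = Data.Unit.⊤ where import Data.Unit
Full (un t) = Data.Empty.⊥ where import Data.Empty
Full (bin l r) = Full l × Full r

-- X_v = Z_v ∩ X, where X embeds into Z via inj.
memb : ∀ {Z : Set} → DecidableEquality Z → Z → List Z → Bool
memb eq z zs = any (λ z' → ⌊ eq z z' ⌋) zs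

varsBelow : ∀ {n} {Z : Set} → DecidableEquality Z → (Fin n → Z) → VTree Z → Fin n → Bool
varsBelow eq inj T x = memb eq (inj x) (leaves T)

fwT : ∀ {n} {Z : Set} → DecidableEquality Z → (Fin n → Z) → BF n → VTree Z → ℕ
fwT eq inj F T@(leaf _) = length (factors F (varsBelow eq inj T))
fwT eq inj F T@(un t) = length (factors F (varsBelow eq inj T)) ⊔ fwT eq inj F t
fwT eq inj F T@(bin l r) =
  length (factors F (varsBelow eq inj T)) ⊔ fwT eq inj F l ⊔ fwT eq inj F r

-- Vtrees for Z ⊇ X: Z = X ⊎ (e extra variables).
ZVar : ℕ → ℕ → Set
ZVar n e = Fin n ⊎ Fin e

zeq : ∀ {n e} → DecidableEquality (ZVar n e)
zeq = SumP.≡-dec FinP._≟_ FinP._≟_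

IsFw : ∀ {n} → BF n → ℕ → Set
IsFw {n} F k =
  (Σ[ e ∈ ℕ ] Σ[ T ∈ VTree (ZVar n e) ] IsVTreeFor T × fwT zeq inj₁ F T ≡ k)
  × ((e : ℕ) (T : VTree (ZVar n e)) → IsVTreeFor T → k ≤ fwT zeq inj₁ F T)

-- The ∧-gates of C_{F,T} structured by an inner node v (children w,w') are
-- the gates C_{w,G} ∧ C_{w',G'} for (G,G') ∈ impl(F,H,X_w,X_{w'}) with
-- C_{v,H} a gate of C_{F,T} (i.e. reachable from the output C_{r,F}).
-- `fiwGo T Hs` : Hs = list of H with C_{v,H} in C_{F,T} for v the root of T.

sameFn2? : ∀ {n} (p q : BF n × BF n) →
  Relation.Nullary.Decidable.Dec (SameFn (proj₁ p) (proj₁ q) × SameFn (proj₂ p) (proj₂ q))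
sameFn2? (f , g) (f' , g') = sameFn? f f' Relation.Nullary.Decidable.×-dec sameFn? g g'

module _ {n : ℕ} (F : BF n) where
  Xv : VTree (Fin n) → Fin n → Bool
  Xv = varsBelow FinP._≟_ (λ x → x)

  andGatesAt : VTree (Fin n) → VTree (Fin n) → List (BF n) → List (BF n × BF n)
  andGatesAt l r Hs = deduplicate sameFn2? (concatMap (λ H → impl F H (Xv l) (Xv r)) Hs)

  fiwGo : VTree (Fin n) → List (BF n) → ℕ
  fiwGo (leaf x) Hs = 0
  fiwGo (un t) Hs = fiwGo t Hs   -- never used: fiw only considers Full vtrees
  fiwGo (bin l r) Hs =
    length gs
      ⊔ fiwGo l (deduplicate sameFn? (map proj₁ gs))
      ⊔ fiwGo r (deduplicate sameFn? (map proj₂ gs))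
    where gs = andGatesAt l r Hs

  fiwT : VTree (Fin n) → ℕ
  fiwT T = fiwGo T (F ∷ [])

IsFiw : ∀ {n} → BF n → ℕ → Set
IsFiw {n} F k =
  (Σ[ T ∈ VTree (Fin n) ] IsVTreeFor T × Full T × fiwT F T ≡ k)
  × ((T : VTree (Fin n)) → IsVTreeFor T → Full T → k ≤ fiwT F T)

-- Gates are numbered so that gate 0 is the most recently
-- added one; a gate added on top of k earlier gates may only take inputs
-- among those (index : Fin k), so the circuit is a DAG (every DAG admits
-- such a topological numbering).

data Gate (n k : ℕ) : Set where
  var  : Fin n → Gate n k
  cst  : Bool → Gate n k
  andG : List (Fin k) → Gate n k
  orG  : List (Fin k) → Gate n k
  negG : Fin k → Gate n k

data Gates (n : ℕ) : ℕ → Set where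
  []  : Gates n 0
  _◁_ : ∀ {k} → Gate n k → Gates n k → Gates n (suc k)

gateInputs : ∀ {n k} → Gate n k → List (Fin k)
gateInputs (var x) = []
gateInputs (cst b) = []
gateInputs (andG js) = js
gateInputs (orG js) = js
gateInputs (negG j) = j ∷ []

inputsOf : ∀ {n k} → Gates n k → Fin k → List (Fin k)
inputsOf (g ◁ gs) zero = map suc (gateInputs g)
inputsOf (g ◁ gs) (suc i) = map suc (inputsOf gs i)

gateVar : ∀ {n k} → Gate n k → Maybe (Fin n)
gateVar (var x) = just x
gateVar _ = nothing

varOf : ∀ {n k} → Gates n k → Fin k → Maybe (Fin n)
varOf (g ◁ gs) zero = gateVar g
varOf (g ◁ gs) (suc i) = varOf gs i

evalGate : ∀ {n k} → Gate n k → Vec Bool k → Assign n → Bool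
evalGate (var x) vs a = a x
evalGate (cst b) vs a = b
evalGate (andG js) vs a = and (map (lookup vs) js)
evalGate (orG js) vs a = or (map (lookup vs) js)
evalGate (negG j) vs a = not (lookup vs j)

evalGates : ∀ {n k} → Gates n k → Assign n → Vec Bool k
evalGates [] a = []
evalGates (g ◁ gs) a = let vs = evalGates gs a in evalGate g vs a ∷ vs

record Circuit (n : ℕ) : Set where
  field
    size   : ℕ
    gates  : Gates n size
    output : Fin size
    distinctVars : ∀ i j x → varOf gates i ≡ just x → varOf gates j ≡ just x → i ≡ j

Computes : ∀ {n} → Circuit n → BF n → Set
Computes C F = ∀ a → lookup (evalGates (Circuit.gates C) a) (Circuit.output C) ≡ F a

-- underlying undirected graph: vertices = gates, edge {i,j} iff j is an input of i
Wire : ∀ {n} (C : Circuit n) → Fin (Circuit.size C) → Fin (Circuit.size C) → Set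
Wire C i j = j ∈ inputsOf (Circuit.gates C) i

-- Tree decompositions (rooted tree of bags; nodes addressed by paths).

data BagTree (m : ℕ) : Set where
  node : Subset m → List (BagTree m) → BagTree m

mutual
  bagAt : ∀ {m} → BagTree m → List ℕ → Maybe (Subset m)
  bagAt (node b cs) [] = just b
  bagAt (node b cs) (k ∷ p) = bagAtChild cs k p

  bagAtChild : ∀ {m} → List (BagTree m) → ℕ → List ℕ → Maybe (Subset m)
  bagAtChild [] k p = nothing
  bagAtChild (c ∷ cs) zero p = bagAt c p
  bagAtChild (c ∷ cs) (suc k) p = bagAtChild cs k p

InBag : ∀ {m} → Fin m → BagTree m → List ℕ → Set
InBag {m} i T p = Σ[ b ∈ Subset m ] (bagAt T p ≡ just b × i ∈ₛ b)

data _≼_ : List ℕ → List ℕ → Set where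
  []≼ : ∀ {p} → [] ≼ p
  ∷≼  : ∀ {k r p} → r ≼ p → (k ∷ r) ≼ (k ∷ p)

record TreeDecomp {m : ℕ} (E : Fin m → Fin m → Set) (w : ℕ) : Set where
  field
    tree : BagTree m
    coverV : ∀ i → ∃[ p ] InBag i tree p
    coverE : ∀ i j → E i j → ∃[ p ] (InBag i tree p × InBag j tree p)
    -- the nodes whose bag contains i form a connected subtree:
    -- r lies on the tree path between p and q iff r is an ancestor of p or
    -- of q and lies below every common ancestor of p and q.
    connected : ∀ i p q r → InBag i tree p → InBag i tree q →
      (r ≼ p ⊎ r ≼ q) → (∀ s → s ≼ p → s ≼ q → s ≼ r) → InBag i tree r
    -- width = max bag size − 1 ≤ w
    narrow : ∀ p b → bagAt tree p ≡ just b → ∣ b ∣ ≤ suc w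

IsCtw : ∀ {n} → BF n → ℕ → Set
IsCtw {n} F k =
  (Σ[ C ∈ Circuit n ] Computes C F × TreeDecomp (Wire C) k)
  × ((C : Circuit n) → Computes C F → (w : ℕ) → TreeDecomp (Wire C) w → k ≤ w)

module Submission where

-- fiw ≤ fw²: restricting a vtree for Z ⊇ X to X keeps every set X_v, and the ∧-gates structured by
-- a node with children w, w' are distinct pairs of factors relative to X_w and X_{w'}.
--
-- fw² ≤ 2^((ctw+2)·2^(ctw+2)): take a circuit with a tree decomposition of width c and attach every
-- variable to a bag containing its input gate. The vtree following the decomposition has at each node
-- a variable set S separated from the rest of the circuit by one bag of at most c+1 gates. The cofactor
-- at an assignment b of S is determined by what the S-side of the circuit passes to that bag and to the
-- output under each of the 2^(c+1) ways of fixing the bag, so there are at most 2^((c+2)·2^(c+1)) factors.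

open import Defs
open import Algebra.Bundles using (CommutativeMonoid)
open import Data.Bool using (Bool; true; false; _∧_; _∨_; not; if_then_else_; T?)
open import Data.Bool.ListAction using (and; or)
import Data.Bool.Properties as BoolP
open import Data.Empty using (⊥; ⊥-elim)
open import Data.Fin using (Fin; zero; suc; toℕ; _≟_)
open import Data.Fin.Induction using (>-wellFounded)
import Data.Fin.Properties as FinP
open import Data.Fin.Subset using (Subset; ∣_∣) renaming (_∈_ to _∈ₛ_)
open import Data.Fin.Subset.Properties using (_∈?_)
open import Data.List using (List; []; _∷_; _++_; map; foldr; length; concatMap; cartesianProduct;
  filter; filterᵇ; deduplicate; allFin)
open import Data.List.Membership.Propositional using (_∈_)
import Data.List.Membership.Propositional.Properties as ∈P
open import Data.List.Relation.Unary.All as All using (All; []; _∷_)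
import Data.List.Relation.Unary.All.Properties as AllP
open import Data.List.Relation.Unary.AllPairs as AllPairs using (AllPairs; []; _∷_)
import Data.List.Relation.Unary.AllPairs.Properties as AllPairsP
open import Data.List.Relation.Unary.Any as Any using (here; there)
open import Data.List.Relation.Unary.Unique.Propositional using (Unique)
import Data.List.Relation.Unary.Unique.Propositional.Properties as UniqueP
import Data.List.Properties as ListP
open import Data.Maybe using (Maybe; just; nothing)
import Data.Maybe as Maybe
import Data.Maybe.Properties as MaybeP
import Data.Maybe.Relation.Unary.All as MaybeAll
open import Data.Nat using (ℕ; zero; suc; _+_; _*_; _^_; _<_; _≤_; z≤n; s≤s)
import Data.Nat.Properties as ℕP
open import Data.Nat.Tactic.RingSolver using (solve-∀)
open import Data.Product using (Σ; ∃; ∃₂; _×_; _,_; proj₁; proj₂)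
open import Data.Sum using (_⊎_; inj₁; inj₂; [_,_]′)
open import Data.Unit using (tt)
open import Data.Vec using (Vec; []; _∷_; lookup)
import Data.Vec.Base as Vec
open import Data.Vec.Functional using (updateAt)
import Data.Vec.Functional.Properties as VecFP
open import Function using (_∘_; const; _⟨_⟩_)
open import Function.Bundles using (Equivalence)
import Induction.WellFounded as WF
open import Relation.Binary.Bundles using (Setoid)
open import Relation.Binary.Definitions using (DecidableEquality; Decidable)
open import Relation.Binary.PropositionalEquality
  using (_≡_; _≢_; refl; sym; trans; cong; cong₂; subst; module ≡-Reasoning)
open import Relation.Nullary using (¬_; Dec; yes; no; ¬?)
open import Relation.Nullary.Decidable using (⌊_⌋)

remove : ∀ {A : Set} {x : A} (xs : List A) → x ∈ xs → List A
remove (_ ∷ xs) (here _)  = xs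
remove (y ∷ xs) (there p) = y ∷ remove xs p

length-remove : ∀ {A : Set} {x : A} (xs : List A) (p : x ∈ xs) →
  length xs ≡ suc (length (remove xs p))
length-remove (_ ∷ xs) (here _)  = refl
length-remove (_ ∷ xs) (there p) = cong suc (length-remove xs p)

∈-remove : ∀ {A : Set} {x y : A} (xs : List A) (p : x ∈ xs) → y ∈ xs → y ≢ x → y ∈ remove xs p
∈-remove (_ ∷ xs) (here refl) (here refl) y≢x = ⊥-elim (y≢x refl)
∈-remove (_ ∷ xs) (here refl) (there q)   y≢x = q
∈-remove (_ ∷ xs) (there p)   (here refl) y≢x = here refl
∈-remove (_ ∷ xs) (there p)   (there q)   y≢x = there (∈-remove xs p q y≢x)

Unique⇒length≤ : ∀ {A : Set} (ys zs : List A) → Unique ys → All (_∈ zs) ys → length ys ≤ length zs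
Unique⇒length≤ []       zs _              _             = z≤n
Unique⇒length≤ (y ∷ ys) zs (y≢ys ∷ ys!) (y∈zs ∷ ys⊆zs) = begin
  suc (length ys)                ≤⟨ s≤s (Unique⇒length≤ ys (remove zs y∈zs) ys! ys⊆zs-y) ⟩
  suc (length (remove zs y∈zs))  ≡⟨ sym (length-remove zs y∈zs) ⟩
  length zs                      ∎
  where
  open ℕP.≤-Reasoning
  ys⊆zs-y : All (_∈ remove zs y∈zs) ys
  ys⊆zs-y = All.zipWith (λ (y≢z , z∈zs) → ∈-remove zs y∈zs z∈zs (y≢z ∘ sym)) (y≢ys , ys⊆zs)

module _ {X : Set} {R : X → X → Set} (R? : Decidable R) where

  deduplicate-AllPairs : ∀ xs → AllPairs (λ x y → ¬ R x y) (deduplicate R? xs)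
  deduplicate-AllPairs []       = []
  deduplicate-AllPairs (x ∷ xs) =
    AllP.all-filter (¬? ∘ R? x) (deduplicate R? xs) ∷ AllPairsP.filter⁺ (¬? ∘ R? x) (deduplicate-AllPairs xs)

  module _ {A C : Set} (g : A → X) (code : A → C)
    (code-separates : ∀ a a' → code a ≡ code a' → R (g a) (g a')) where

    private
      preimages : ∀ xs → All (λ x → ∃ λ a → x ≡ g a) xs → Σ (List A) λ as → map g as ≡ xs
      preimages []       []                = [] , refl
      preimages (x ∷ xs) ((a , refl) ∷ ws) =
        let as , eq = preimages xs ws in a ∷ as , cong (g a ∷_) eq

    length-deduplicate-≤ : ∀ (as : List A) (cs : List C) → (∀ a → code a ∈ cs) →
      length (deduplicate R? (map g as)) ≤ length cs
    length-deduplicate-≤ as cs code∈cs with preimages _ (All.tabulate has-preimage)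
      where
      has-preimage : ∀ {x} → x ∈ deduplicate R? (map g as) → ∃ λ a → x ≡ g a
      has-preimage x∈ = let a , _ , eq = ∈P.∈-map⁻ g (∈P.∈-deduplicate⁻ R? (map g as) x∈) in a , eq
    ... | bs , eq = begin
      length (deduplicate R? (map g as))  ≡⟨ cong length (sym eq) ⟩
      length (map g bs)                   ≡⟨ ListP.length-map g bs ⟩
      length bs                           ≡⟨ sym (ListP.length-map code bs) ⟩
      length (map code bs)                ≤⟨ Unique⇒length≤ (map code bs) cs codes! codes∈cs ⟩
      length cs                           ∎
      where
      open ℕP.≤-Reasoning
      codes! : Unique (map code bs)
      codes! = AllPairsP.map⁺ (AllPairs.map (λ ¬R c≡c' → ¬R (code-separates _ _ c≡c'))
                 (AllPairsP.map⁻ (subst (AllPairs _) (sym eq) (deduplicate-AllPairs (map g as)))))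
      codes∈cs : All (_∈ cs) (map code bs)
      codes∈cs = AllP.map⁺ (All.tabulate (λ {b} _ → code∈cs b))

length-concatMap-const : ∀ {A B : Set} (f : A → List B) k → (∀ x → length (f x) ≡ k) → ∀ xs →
  length (concatMap f xs) ≡ length xs * k
length-concatMap-const f k len-f []       = refl
length-concatMap-const f k len-f (x ∷ xs) =
  trans (ListP.length-++ (f x)) (cong₂ _+_ (len-f x) (length-concatMap-const f k len-f xs))

length-cartesianProduct : ∀ {A B : Set} (xs : List A) (ys : List B) →
  length (cartesianProduct xs ys) ≡ length xs * length ys
length-cartesianProduct []       ys = refl
length-cartesianProduct (x ∷ xs) ys =
  trans (ListP.length-++ (map (x ,_) ys))
        (cong₂ _+_ (ListP.length-map (x ,_) ys) (length-cartesianProduct xs ys))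

map-≡⇒≡ : ∀ {A B : Set} {f g : A → B} xs {x} → map f xs ≡ map g xs → x ∈ xs → f x ≡ g x
map-≡⇒≡ (y ∷ xs) eq (here refl) = proj₁ (ListP.∷-injective eq)
map-≡⇒≡ (y ∷ xs) eq (there x∈)  = map-≡⇒≡ xs (proj₂ (ListP.∷-injective eq)) x∈

Unique-++⁻ : ∀ {A : Set} (xs ys : List A) → Unique (xs ++ ys) →
  Unique xs × Unique ys × (∀ {v} → v ∈ xs → v ∈ ys → ⊥)
Unique-++⁻ []       ys ys!          = [] , ys! , λ ()
Unique-++⁻ (x ∷ xs) ys (x∉ ∷ rest!) with xs! , ys! , disjoint ← Unique-++⁻ xs ys rest! =
  AllP.++⁻ˡ xs x∉ ∷ xs! , ys! , λ where
    (here refl) v∈ys → All.lookup (AllP.++⁻ʳ xs x∉) v∈ys refl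
    (there v∈)  v∈ys → disjoint v∈ v∈ys

listsOver : ∀ {A : Set} → List A → ℕ → List (List A)
listsOver xs zero    = [] ∷ []
listsOver xs (suc L) = concatMap (λ ys → map (_∷ ys) xs) (listsOver xs L)

length-listsOver : ∀ {A : Set} (xs : List A) L → length (listsOver xs L) ≡ length xs ^ L
length-listsOver xs zero    = refl
length-listsOver xs (suc L) = begin
  length (listsOver xs (suc L))      ≡⟨ length-concatMap-const _ (length xs) (λ ys → ListP.length-map (_∷ ys) xs) (listsOver xs L) ⟩
  length (listsOver xs L) * length xs ≡⟨ cong (_* length xs) (length-listsOver xs L) ⟩
  length xs ^ L * length xs           ≡⟨ ℕP.*-comm (length xs ^ L) (length xs) ⟩
  length xs ^ suc L                   ∎
  where open ≡-Reasoning

∈-listsOver : ∀ {A : Set} (xs ys : List A) → All (_∈ xs) ys → ys ∈ listsOver xs (length ys)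
∈-listsOver xs []       []           = here refl
∈-listsOver xs (y ∷ ys) (y∈ ∷ ys⊆xs) =
  ∈P.∈-concatMap⁺ (λ zs → map (_∷ zs) xs) (Any.map (λ { refl → ∈P.∈-map⁺ (_∷ ys) y∈ }) (∈-listsOver xs ys ys⊆xs))

-- Circuits as systems of gate equations

-- A gate with its input wires forgotten: evaluation takes the list of input values.
data GateKind (n : ℕ) : Set where
  kvar : Fin n → GateKind n
  kcst : Bool → GateKind n
  kand kor kneg : GateKind n

kindOfGate : ∀ {n k} → Gate n k → GateKind n
kindOfGate (var x)  = kvar x
kindOfGate (cst b)  = kcst b
kindOfGate (andG _) = kand
kindOfGate (orG _)  = kor
kindOfGate (negG _) = kneg

kindOf : ∀ {n k} → Gates n k → Fin k → GateKind n
kindOf (g ◁ gs) zero    = kindOfGate g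
kindOf (g ◁ gs) (suc i) = kindOf gs i

evalKind : ∀ {n} → GateKind n → List Bool → Assign n → Bool
evalKind (kvar x) vs       a = a x
evalKind (kcst b) vs       a = b
evalKind kand     vs       a = and vs
evalKind kor      vs       a = or vs
evalKind kneg     []       a = true   -- never used: a negation gate has one input
evalKind kneg     (v ∷ _)  a = not v

evalKind-cong : ∀ {n} k {vs vs'} (a a' : Assign n) → vs ≡ vs' → (∀ x → k ≡ kvar x → a x ≡ a' x) →
  evalKind k vs a ≡ evalKind k vs' a'
evalKind-cong (kvar x) a a' _    a≗a' = a≗a' x refl
evalKind-cong (kcst b) a a' _    _    = refl
evalKind-cong kand     a a' refl _    = refl
evalKind-cong kor      a a' refl _    = refl
evalKind-cong kneg {[]}    a a' refl _ = refl
evalKind-cong kneg {_ ∷ _} a a' refl _ = refl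

varOf⇒kindOf : ∀ {n k} (gs : Gates n k) i x → varOf gs i ≡ just x → kindOf gs i ≡ kvar x
varOf⇒kindOf (var _ ◁ gs) zero    x refl = refl
varOf⇒kindOf (cst _ ◁ gs) zero    x ()
varOf⇒kindOf (andG _ ◁ gs) zero   x ()
varOf⇒kindOf (orG _ ◁ gs) zero    x ()
varOf⇒kindOf (negG _ ◁ gs) zero   x ()
varOf⇒kindOf (g ◁ gs)     (suc i) x eq = varOf⇒kindOf gs i x eq

kindOf⇒varOf : ∀ {n k} (gs : Gates n k) i x → kindOf gs i ≡ kvar x → varOf gs i ≡ just x
kindOf⇒varOf (var _ ◁ gs) zero    x refl = refl
kindOf⇒varOf (cst _ ◁ gs) zero    x ()
kindOf⇒varOf (andG _ ◁ gs) zero   x ()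
kindOf⇒varOf (orG _ ◁ gs) zero    x ()
kindOf⇒varOf (negG _ ◁ gs) zero   x ()
kindOf⇒varOf (g ◁ gs)     (suc i) x eq = kindOf⇒varOf gs i x eq

map-lookup-suc : ∀ {k} v (vs : Vec Bool k) (js : List (Fin k)) →
  map (lookup (v ∷ vs)) (map suc js) ≡ map (lookup vs) js
map-lookup-suc v vs js = sym (ListP.map-∘ js)

evalGate-evalKind : ∀ {n k} (g : Gate n k) v (vs : Vec Bool k) a →
  evalGate g vs a ≡ evalKind (kindOfGate g) (map (lookup (v ∷ vs)) (map suc (gateInputs g))) a
evalGate-evalKind (var x)   v vs a = refl
evalGate-evalKind (cst b)   v vs a = refl
evalGate-evalKind (andG js) v vs a = cong and (sym (map-lookup-suc v vs js))
evalGate-evalKind (orG js)  v vs a = cong or (sym (map-lookup-suc v vs js))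
evalGate-evalKind (negG j)  v vs a = refl

evalGates-local : ∀ {n k} (gs : Gates n k) a i → let val = lookup (evalGates gs a) in
  val i ≡ evalKind (kindOf gs i) (map val (inputsOf gs i)) a
evalGates-local (g ◁ gs) a zero    = evalGate-evalKind g _ (evalGates gs a) a
evalGates-local (g ◁ gs) a (suc i) =
  trans (evalGates-local gs a i)
        (cong (λ vs → evalKind (kindOf gs i) vs a) (sym (map-lookup-suc _ (evalGates gs a) (inputsOf gs i))))

evalOverriding : ∀ {n k} → Gates n k → (over σ : Fin k → Bool) → Assign n → Vec Bool k
evalOverriding []       over σ a = []
evalOverriding (g ◁ gs) over σ a =
  let vs = evalOverriding gs (over ∘ suc) (σ ∘ suc) a in
  (if over zero then σ zero else evalGate g vs a) ∷ vs

evalOverriding-local : ∀ {n k} (gs : Gates n k) over σ a i → let val = lookup (evalOverriding gs over σ a) in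
  val i ≡ (if over i then σ i else evalKind (kindOf gs i) (map val (inputsOf gs i)) a)
evalOverriding-local (g ◁ gs) over σ a zero with over zero
... | true  = refl
... | false = evalGate-evalKind g _ (evalOverriding gs (over ∘ suc) (σ ∘ suc) a) a
evalOverriding-local (g ◁ gs) over σ a (suc i) =
  trans (evalOverriding-local gs (over ∘ suc) (σ ∘ suc) a i)
        (cong (λ vs → if over (suc i) then σ (suc i) else evalKind (kindOf gs i) vs a)
              (sym (map-lookup-suc _ (evalOverriding gs (over ∘ suc) (σ ∘ suc) a) (inputsOf gs i))))

input-later : ∀ {n k} (gs : Gates n k) i j → j ∈ inputsOf gs i → toℕ i < toℕ j
input-later (g ◁ gs) zero    j j∈ with ∈P.∈-map⁻ suc j∈
... | _ , _ , refl = s≤s z≤n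
input-later (g ◁ gs) (suc i) j j∈ with ∈P.∈-map⁻ suc j∈
... | j' , j'∈ , refl = s≤s (input-later gs i j' j'∈)

-- Inputs have larger indices than the gates reading them (gate 0 is the newest).
gateInduction : ∀ {m} (Q : Fin m → Set) → (∀ i → (∀ j → toℕ i < toℕ j → Q j) → Q i) → ∀ i → Q i
gateInduction Q step = WF.All.wfRec >-wellFounded _ Q (λ i ih → step i (λ j i<j → ih i<j))

module _ {n m : ℕ} (gs : Gates n m) where

  inputInduction : (Q : Fin m → Set) → (∀ i → (∀ j → j ∈ inputsOf gs i → Q j) → Q i) → ∀ i → Q i
  inputInduction Q step = gateInduction Q (λ i ih → step i (λ j j∈ → ih j (input-later gs i j j∈)))

  map-cong-inputs : ∀ {f g : Fin m → Bool} i → (∀ j → j ∈ inputsOf gs i → f j ≡ g j) →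
    map f (inputsOf gs i) ≡ map g (inputsOf gs i)
  map-cong-inputs i f≗g = ListP.map-cong-local (All.tabulate (λ {j} j∈ → f≗g j j∈))

  evalGates-unique : ∀ a (ν : Fin m → Bool) → (∀ i → ν i ≡ evalKind (kindOf gs i) (map ν (inputsOf gs i)) a) →
    ∀ i → ν i ≡ lookup (evalGates gs a) i
  evalGates-unique a ν ν-local = inputInduction _ λ i ih →
    trans (ν-local i) (trans (cong (λ vs → evalKind (kindOf gs i) vs a) (map-cong-inputs i ih))
                             (sym (evalGates-local gs a i)))

evalGates-ext : ∀ {n k} (gs : Gates n k) (a a' : Assign n) → (∀ x → a x ≡ a' x) → evalGates gs a ≡ evalGates gs a'
evalGates-ext []       a a' a≗a' = refl
evalGates-ext (g ◁ gs) a a' a≗a' rewrite evalGates-ext gs a a' a≗a' = cong (_∷ evalGates gs a') (evalGate-ext g)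
  where
  evalGate-ext : ∀ g → evalGate g (evalGates gs a') a ≡ evalGate g (evalGates gs a') a'
  evalGate-ext (var x)  = a≗a' x
  evalGate-ext (cst _)  = refl
  evalGate-ext (andG _) = refl
  evalGate-ext (orG _)  = refl
  evalGate-ext (negG _) = refl

Computes⇒ext : ∀ {n} {C : Circuit n} {F : BF n} → Computes C F → ∀ a a' → (∀ x → a x ≡ a' x) → F a ≡ F a'
Computes⇒ext {C = C} C⇒F a a' a≗a' =
  trans (sym (C⇒F a)) (trans (cong (λ vs → lookup vs (Circuit.output C)) (evalGates-ext (Circuit.gates C) a a' a≗a'))
                             (C⇒F a'))

-- Separators bound the number of factors

module _ {c ℓ} (M : CommutativeMonoid c ℓ) where
  open CommutativeMonoid M using (Carrier; _≈_; _∙_; ε; setoid; identityˡ; assoc; ∙-congˡ; commutativeSemigroup)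
  open Setoid setoid using () renaming (sym to ≈-sym)
  open import Algebra.Properties.CommutativeSemigroup commutativeSemigroup using (x∙yz≈y∙xz)
  open import Relation.Binary.Reasoning.Setoid setoid

  foldr-partition : ∀ {A : Set} (p : A → Bool) (ν : A → Carrier) xs →
    foldr _∙_ ε (map ν xs) ≈ foldr _∙_ ε (map ν (filterᵇ p xs)) ∙ foldr _∙_ ε (map ν (filterᵇ (not ∘ p) xs))
  foldr-partition p ν []       = ≈-sym (identityˡ ε)
  foldr-partition p ν (x ∷ xs) with p x
  ... | true  = begin
    ν x ∙ foldr _∙_ ε (map ν xs)  ≈⟨ ∙-congˡ (foldr-partition p ν xs) ⟩
    ν x ∙ (_ ∙ _)                 ≈⟨ ≈-sym (assoc _ _ _) ⟩
    (ν x ∙ _) ∙ _                 ∎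
  ... | false = begin
    ν x ∙ foldr _∙_ ε (map ν xs)  ≈⟨ ∙-congˡ (foldr-partition p ν xs) ⟩
    ν x ∙ (_ ∙ _)                 ≈⟨ x∙yz≈y∙xz _ _ _ ⟩
    _ ∙ (ν x ∙ _)                 ∎

bools : List Bool
bools = false ∷ true ∷ []

∈-bools : ∀ v → v ∈ bools
∈-bools false = here refl
∈-bools true  = there (here refl)

Bool-cases : ∀ b → b ≡ true ⊎ b ≡ false
Bool-cases true  = inj₁ refl
Bool-cases false = inj₂ refl

∧-cancel-true : ∀ {s x y} → s ≡ true → s ∧ x ≡ s ∧ y → x ≡ y
∧-cancel-true refl eq = eq

contraposeᵇ : ∀ {b c : Bool} → (b ≡ true → c ≡ true) → c ≡ false → b ≡ false
contraposeᵇ {false} _   _   = refl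
contraposeᵇ {true}  b⇒c c≡f with () ← trans (sym (b⇒c refl)) c≡f

-- All assignments that are false outside the list gs.
assignmentsOn : ∀ {m} → List (Fin m) → List (Fin m → Bool)
assignmentsOn []       = (λ _ → false) ∷ []
assignmentsOn (g ∷ gs) = concatMap (λ σ → map (λ v → updateAt σ g (const v)) bools) (assignmentsOn gs)

length-assignmentsOn : ∀ {m} (gs : List (Fin m)) → length (assignmentsOn gs) ≡ 2 ^ length gs
length-assignmentsOn []       = refl
length-assignmentsOn (g ∷ gs) =
  trans (length-concatMap-const _ 2 (λ _ → refl) (assignmentsOn gs))
        (trans (cong (_* 2) (length-assignmentsOn gs)) (ℕP.*-comm (2 ^ length gs) 2))

assignmentsOn-complete : ∀ {m} (gs : List (Fin m)) (ν : Fin m → Bool) →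
  ∃ λ σ → σ ∈ assignmentsOn gs × (∀ g → g ∈ gs → σ g ≡ ν g)
assignmentsOn-complete []       ν = _ , here refl , λ _ ()
assignmentsOn-complete (g ∷ gs) ν =
  let σ , σ∈ , σ≗ν = assignmentsOn-complete gs ν in
  updateAt σ g (const (ν g)) ,
  ∈P.∈-concatMap⁺ (λ σ → map (λ v → updateAt σ g (const v)) bools) (Any.map (λ { refl → ∈P.∈-map⁺ (λ v → updateAt σ g (const v)) (∈-bools (ν g)) }) σ∈) ,
  agrees σ σ≗ν
  where
  agrees : ∀ σ → (∀ h → h ∈ gs → σ h ≡ ν h) → ∀ h → h ∈ g ∷ gs → updateAt σ g (const (ν g)) h ≡ ν h
  agrees σ σ≗ν h h∈ with h ≟ g
  ... | yes refl = VecFP.updateAt-updates g σ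
  agrees σ σ≗ν h (here refl) | no h≢g = ⊥-elim (h≢g refl)
  agrees σ σ≗ν h (there h∈)  | no h≢g = trans (VecFP.updateAt-minimal h g σ h≢g) (σ≗ν h h∈)

-- The gates are split into separator gates (sep), inner gates and the remaining outer gates:
-- no wire joins an inner gate to an outer one, inner gates read only variables in S and
-- outer gates only variables outside S.
record Separation {n m : ℕ} (gs : Gates n m) (S : Fin n → Bool) (w : ℕ) : Set where
  field
    sep inner : Fin m → Bool
    sepList : List (Fin m)
    length-sepList : length sepList ≤ suc w
    sep⇒∈sepList : ∀ i → sep i ≡ true → i ∈ sepList
    inner⇒¬sep : ∀ i → inner i ≡ true → sep i ≡ false
    input-of-inner : ∀ i j → j ∈ inputsOf gs i → inner i ≡ true → sep j ≡ false → inner j ≡ true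
    reads-inner : ∀ i j → j ∈ inputsOf gs i → inner j ≡ true → sep i ≡ false → inner i ≡ true
    var∈S : ∀ g x → kindOf gs g ≡ kvar x → S x ≡ true → inner g ≡ false → sep g ≡ true
    var∉S : ∀ g x → kindOf gs g ≡ kvar x → S x ≡ false → inner g ≡ false

merge-in : ∀ {n} (S : Fin n → Bool) b a a' x → S x ≡ true → merge S b a x ≡ merge S b a' x
merge-in S b a a' x Sx = cong (λ s → if s then b x else a x) Sx ⟨ trans ⟩ sym (cong (λ s → if s then b x else a' x) Sx)

merge-out : ∀ {n} (S : Fin n → Bool) b b' a x → S x ≡ false → merge S b a x ≡ merge S b' a x
merge-out S b b' a x Sx = cong (λ s → if s then b x else a x) Sx ⟨ trans ⟩ sym (cong (λ s → if s then b' x else a x) Sx)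

module SeparationBound {n m : ℕ} (gs : Gates n m) (out : Fin m) (F : BF n)
  (gs⇒F : ∀ a → lookup (evalGates gs a) out ≡ F a)
  {S : Fin n → Bool} {w : ℕ} (sepn : Separation gs S w) where

  open Separation sepn

  private
    kd : Fin m → GateKind n
    kd = kindOf gs
    ins : Fin m → List (Fin m)
    ins = inputsOf gs

  value : Assign n → Fin m → Bool
  value c = lookup (evalGates gs c)

  forced : (Fin m → Bool) → Assign n → Fin m → Bool
  forced σ c = lookup (evalOverriding gs sep σ c)

  forced-value : ∀ c i → forced (value c) c i ≡ value c i
  forced-value c = inputInduction gs _ λ i ih →
    trans (evalOverriding-local gs sep (value c) c i) (by-cases i ih (sep i))
    where
    by-cases : ∀ i → (∀ j → j ∈ ins i → forced (value c) c j ≡ value c j) → ∀ s →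
      (if s then value c i else evalKind (kd i) (map (forced (value c) c) (ins i)) c) ≡ value c i
    by-cases i ih true  = refl
    by-cases i ih false =
      trans (cong (λ vs → evalKind (kd i) vs c) (map-cong-inputs gs i ih)) (sym (evalGates-local gs c i))

  forced-cong : ∀ {σ σ' c c'} i → (sep i ≡ true → σ i ≡ σ' i) →
    (sep i ≡ false →
      evalKind (kd i) (map (forced σ c) (ins i)) c ≡ evalKind (kd i) (map (forced σ' c') (ins i)) c') →
    forced σ c i ≡ forced σ' c' i
  forced-cong {σ} {σ'} {c} {c'} i on-sep off-sep =
    trans (evalOverriding-local gs sep σ c i) (trans (by-cases (sep i) refl) (sym (evalOverriding-local gs sep σ' c' i)))
    where
    by-cases : ∀ s → sep i ≡ s →
      (if s then σ i else evalKind (kd i) (map (forced σ c) (ins i)) c) ≡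
      (if s then σ' i else evalKind (kd i) (map (forced σ' c') (ins i)) c')
    by-cases true  eq = on-sep eq
    by-cases false eq = off-sep eq

  forced-cong-σ : ∀ {σ σ'} c → (∀ g → sep g ≡ true → σ g ≡ σ' g) → ∀ i → forced σ c i ≡ forced σ' c i
  forced-cong-σ c σ≗σ' = inputInduction gs _ λ i ih →
    forced-cong i (σ≗σ' i) (λ _ → cong (λ vs → evalKind (kd i) vs c) (map-cong-inputs gs i ih))

  forced-outer : ∀ σ {c c'} → (∀ x → S x ≡ false → c x ≡ c' x) →
    ∀ i → inner i ≡ false → forced σ c i ≡ forced σ c' i
  forced-outer σ {c} {c'} c≗c' = inputInduction gs _ λ i ih i-outer →
    forced-cong i (λ _ → refl) λ sep-i →
      evalKind-cong (kd i) c c'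
        (map-cong-inputs gs i (λ j j∈ → ih j j∈ (contraposeᵇ (λ j-inner → reads-inner i j j∈ j-inner sep-i) i-outer)))
        (λ x kd≡ → c≗c' x (contraposeᵇ (λ Sx → var∈S i x kd≡ Sx i-outer) sep-i))

  forced-inner : ∀ σ {c c'} → (∀ x → S x ≡ true → c x ≡ c' x) →
    ∀ i → inner i ≡ true ⊎ sep i ≡ true → forced σ c i ≡ forced σ c' i
  forced-inner σ {c} {c'} c≗c' = inputInduction gs _ λ i ih i-inside →
    forced-cong i (λ _ → refl) λ sep-i →
      let i-inner = [ (λ i-inner → i-inner) , (λ sep-i' → ⊥-elim (BoolP.not-¬ sep-i' sep-i)) ]′ i-inside in
      evalKind-cong (kd i) c c'
        (map-cong-inputs gs i (λ j j∈ →
          ih j j∈ ([ inj₂ , (λ sep-j → inj₁ (input-of-inner i j j∈ i-inner sep-j)) ]′ (Bool-cases (sep j)))))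
        (λ x kd≡ → [ c≗c' x , (λ Sx → ⊥-elim (BoolP.not-¬ i-inner (var∉S i x kd≡ Sx))) ]′ (Bool-cases (S x)))

  pad : Assign n → Assign n
  pad b = merge S b (λ _ → false)

  inside : Assign n → (Fin m → Bool) → Fin m → Bool
  inside b σ = forced σ (pad b)

  -- The contribution of the inner part of the circuit to a gate.
  innerPart : GateKind n → List (Fin m) → (Fin m → Bool) → Assign n → Bool
  innerPart (kvar x) js ν c = if S x then c x else false
  innerPart (kcst _) js ν c = false
  innerPart kand     js ν c = and (map ν (filterᵇ inner js))
  innerPart kor      js ν c = or (map ν (filterᵇ inner js))
  innerPart kneg     []      ν c = false
  innerPart kneg     (j ∷ _) ν c = inner j ∧ ν j

  interface : Assign n → (Fin m → Bool) → List Bool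
  interface b σ = (inner out ∧ inside b σ out) ∷ map (λ g → innerPart (kd g) (ins g) (inside b σ) (pad b)) sepList

  code : Assign n → List (List Bool)
  code b = map (interface b) (assignmentsOn sepList)

  private
    map-inner : ∀ {js} {ν ν' : Fin m → Bool} → (∀ j → j ∈ js → inner j ≡ true → ν j ≡ ν' j) →
      map ν (filterᵇ inner js) ≡ map ν' (filterᵇ inner js)
    map-inner {js} ν≗ν' = ListP.map-cong-local (All.tabulate λ j∈ →
      let j∈js , T-inner = ∈P.∈-filter⁻ (T? ∘ inner) {xs = js} j∈ in ν≗ν' _ j∈js (Equivalence.to BoolP.T-≡ T-inner))

    map-outer : ∀ {js} {ν ν' : Fin m → Bool} → (∀ j → j ∈ js → inner j ≡ false → ν j ≡ ν' j) →
      map ν (filterᵇ (not ∘ inner) js) ≡ map ν' (filterᵇ (not ∘ inner) js)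
    map-outer {js} ν≗ν' = ListP.map-cong-local (All.tabulate λ j∈ →
      let j∈js , T-outer = ∈P.∈-filter⁻ (T? ∘ not ∘ inner) {xs = js} j∈ in
      ν≗ν' _ j∈js (BoolP.not-injective (Equivalence.to BoolP.T-≡ T-outer)))

  evalKind-split : ∀ k js {ν ν' ω ω' : Fin m → Bool} {c c' d d' : Assign n} →
    (∀ j → j ∈ js → inner j ≡ false → ν j ≡ ν' j) →
    (∀ j → j ∈ js → inner j ≡ true → ν j ≡ ω j) →
    (∀ j → j ∈ js → inner j ≡ true → ν' j ≡ ω' j) →
    innerPart k js ω d ≡ innerPart k js ω' d' →
    (∀ x → k ≡ kvar x → c x ≡ c' x) →
    evalKind k (map ν js) c ≡ evalKind k (map ν' js) c'
  evalKind-split (kvar x) js _ _ _ _ c≗c' = c≗c' x refl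
  evalKind-split (kcst _) js _ _ _ _ _ = refl
  evalKind-split kand js {ν} {ν'} ν≗ν' ν≗ω ν'≗ω' part≡ _ =
    foldr-partition BoolP.∧-commutativeMonoid inner ν js ⟨ trans ⟩
    cong₂ _∧_ (cong and (map-inner ν≗ω) ⟨ trans ⟩ part≡ ⟨ trans ⟩ sym (cong and (map-inner ν'≗ω')))
              (cong and (map-outer ν≗ν')) ⟨ trans ⟩
    sym (foldr-partition BoolP.∧-commutativeMonoid inner ν' js)
  evalKind-split kor js {ν} {ν'} ν≗ν' ν≗ω ν'≗ω' part≡ _ =
    foldr-partition BoolP.∨-commutativeMonoid inner ν js ⟨ trans ⟩
    cong₂ _∨_ (cong or (map-inner ν≗ω) ⟨ trans ⟩ part≡ ⟨ trans ⟩ sym (cong or (map-inner ν'≗ω')))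
              (cong or (map-outer ν≗ν')) ⟨ trans ⟩
    sym (foldr-partition BoolP.∨-commutativeMonoid inner ν' js)
  evalKind-split kneg [] _ _ _ _ _ = refl
  evalKind-split kneg (j ∷ js) ν≗ν' ν≗ω ν'≗ω' part≡ _ with Bool-cases (inner j)
  ... | inj₂ j-outer = cong not (ν≗ν' j (here refl) j-outer)
  ... | inj₁ j-inner = cong not (ν≗ω j (here refl) j-inner ⟨ trans ⟩
          ∧-cancel-true j-inner part≡ ⟨ trans ⟩ sym (ν'≗ω' j (here refl) j-inner))

  module _ (b b' : Assign n) (same : ∀ σ → σ ∈ assignmentsOn sepList → interface b σ ≡ interface b' σ)
           (a : Assign n) where

    private
      c c' : Assign n
      c  = merge S b a
      c' = merge S b' a
      σ ν' σ₀ : Fin m → Bool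
      σ  = value c
      ν' = forced σ c'
      σ₀ = proj₁ (assignmentsOn-complete sepList σ)

      σ₀≗σ : ∀ g → sep g ≡ true → σ₀ g ≡ σ g
      σ₀≗σ g sep-g = proj₂ (proj₂ (assignmentsOn-complete sepList σ)) g (sep⇒∈sepList g sep-g)

      same-σ₀ : interface b σ₀ ≡ interface b' σ₀
      same-σ₀ = same σ₀ (proj₁ (proj₂ (assignmentsOn-complete sepList σ)))

      same-part : ∀ g → sep g ≡ true →
        innerPart (kd g) (ins g) (inside b σ₀) (pad b) ≡ innerPart (kd g) (ins g) (inside b' σ₀) (pad b')
      same-part g sep-g = map-≡⇒≡ sepList (proj₂ (ListP.∷-injective same-σ₀)) (sep⇒∈sepList g sep-g)

      inner-value : ∀ j → inner j ≡ true → value c j ≡ inside b σ₀ j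
      inner-value j j-inner =
        sym (forced-value c j) ⟨ trans ⟩
        forced-inner σ (λ x → merge-in S b a _ x) j (inj₁ j-inner) ⟨ trans ⟩
        forced-cong-σ (pad b) (λ g sep-g → sym (σ₀≗σ g sep-g)) j

      inner-value' : ∀ j → inner j ≡ true → ν' j ≡ inside b' σ₀ j
      inner-value' j j-inner =
        forced-inner σ (λ x → merge-in S b' a _ x) j (inj₁ j-inner) ⟨ trans ⟩
        forced-cong-σ (pad b') (λ g sep-g → sym (σ₀≗σ g sep-g)) j

      outer-value : ∀ j → inner j ≡ false → value c j ≡ ν' j
      outer-value j j-outer = sym (forced-value c j) ⟨ trans ⟩ forced-outer σ (merge-out S b b' a) j j-outer

      var-agrees : ∀ i x → sep i ≡ true → kd i ≡ kvar x → c x ≡ c' x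
      var-agrees i x sep-i kd≡ = [ in-S , merge-out S b b' a x ]′ (Bool-cases (S x))
        where
        in-S : S x ≡ true → c x ≡ c' x
        in-S Sx = merge-in S b a _ x Sx ⟨ trans ⟩ pad-agrees ⟨ trans ⟩ sym (merge-in S b' a _ x Sx)
          where
          part-x : (if S x then pad b x else false) ≡ (if S x then pad b' x else false)
          part-x = subst (λ k → innerPart k (ins i) (inside b σ₀) (pad b) ≡ innerPart k (ins i) (inside b' σ₀) (pad b'))
                         kd≡ (same-part i sep-i)
          pad-agrees : pad b x ≡ pad b' x
          pad-agrees = subst (λ s → (if s then pad b x else false) ≡ (if s then pad b' x else false)) Sx part-x

      sep-local : ∀ i → sep i ≡ true → σ i ≡ evalKind (kd i) (map ν' (ins i)) c'
      sep-local i sep-i = evalGates-local gs c i ⟨ trans ⟩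
        evalKind-split (kd i) (ins i) (λ j _ → outer-value j) (λ j _ → inner-value j) (λ j _ → inner-value' j)
          (same-part i sep-i) (λ x → var-agrees i x sep-i)

      ν'-local : ∀ i → ν' i ≡ evalKind (kd i) (map ν' (ins i)) c'
      ν'-local i = trans (evalOverriding-local gs sep σ c' i) (by-cases (sep i) refl)
        where
        by-cases : ∀ s → sep i ≡ s →
          (if s then σ i else evalKind (kd i) (map ν' (ins i)) c') ≡ evalKind (kd i) (map ν' (ins i)) c'
        by-cases true  sep-i = sep-local i sep-i
        by-cases false _     = refl

      ν'≗value : ∀ i → ν' i ≡ value c' i
      ν'≗value = evalGates-unique gs c' ν' ν'-local

      output-agrees : value c out ≡ value c' out
      output-agrees with Bool-cases (inner out)
      ... | inj₂ out-outer = outer-value out out-outer ⟨ trans ⟩ ν'≗value out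
      ... | inj₁ out-inner =
        inner-value out out-inner ⟨ trans ⟩
        ∧-cancel-true out-inner (proj₁ (ListP.∷-injective same-σ₀)) ⟨ trans ⟩
        sym (inner-value' out out-inner) ⟨ trans ⟩ ν'≗value out

    cofactor-agrees : F (merge S b a) ≡ F (merge S b' a)
    cofactor-agrees = sym (gs⇒F c) ⟨ trans ⟩ output-agrees ⟨ trans ⟩ gs⇒F c'

  code-separates : ∀ b b' → code b ≡ code b' → SameFn (factorOf F S b) (factorOf F S b')
  code-separates b b' eq =
    ListP.map-cong (λ c → cong (λ t → ⌊ ListP.≡-dec BoolP._≟_ (table (cofactor F S c)) t ⌋) same-table) (allAssign n)
    where
    same-table : table (cofactor F S b) ≡ table (cofactor F S b')
    same-table = ListP.map-cong (cofactor-agrees b b' (λ σ σ∈ → map-≡⇒≡ _ eq σ∈)) (allAssign n)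

  private
    k : ℕ
    k = length sepList

  codes : List (List (List Bool))
  codes = listsOver (listsOver bools (suc k)) (2 ^ k)

  code∈codes : ∀ b → code b ∈ codes
  code∈codes b = subst (λ L → code b ∈ listsOver _ L) length-code
    (∈-listsOver _ (code b) (AllP.map⁺ (All.universal interface∈ (assignmentsOn sepList))))
    where
    length-code : length (code b) ≡ 2 ^ k
    length-code = ListP.length-map (interface b) (assignmentsOn sepList) ⟨ trans ⟩ length-assignmentsOn sepList
    interface∈ : ∀ σ → interface b σ ∈ listsOver bools (suc k)
    interface∈ σ = subst (λ L → interface b σ ∈ listsOver bools L) (cong suc (ListP.length-map _ sepList))
      (∈-listsOver bools (interface b σ) (All.universal ∈-bools _))

  length-factors-≤ : length (factors F S) ≤ 2 ^ ((w + 2) * 2 ^ (w + 1))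
  length-factors-≤ = begin
    length (factors F S)         ≤⟨ length-deduplicate-≤ sameFn? (factorOf F S) code code-separates (allAssign n) codes code∈codes ⟩
    length codes                 ≡⟨ length-listsOver _ (2 ^ k) ⟩
    length (listsOver bools (suc k)) ^ 2 ^ k  ≡⟨ cong (_^ 2 ^ k) (length-listsOver bools (suc k)) ⟩
    (2 ^ suc k) ^ 2 ^ k          ≡⟨ ℕP.^-*-assoc 2 (suc k) (2 ^ k) ⟩
    2 ^ (suc k * 2 ^ k)          ≤⟨ ℕP.^-monoʳ-≤ 2 (ℕP.*-mono-≤ (s≤s length-sepList) (ℕP.^-monoʳ-≤ 2 length-sepList)) ⟩
    2 ^ (suc (suc w) * 2 ^ suc w) ≡⟨ cong₂ (λ p q → 2 ^ (p * 2 ^ q)) (ℕP.+-comm 2 w) (ℕP.+-comm 1 w) ⟩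
    2 ^ ((w + 2) * 2 ^ (w + 1))  ∎
    where open ℕP.≤-Reasoning

-- Tree decompositions

rootBag : ∀ {m} → BagTree m → Subset m
rootBag (node b _) = b

mutual
  subtreeAt : ∀ {m} → BagTree m → List ℕ → Maybe (BagTree m)
  subtreeAt t           []      = just t
  subtreeAt (node _ ts) (k ∷ p) = subtreeAtChild ts k p

  subtreeAtChild : ∀ {m} → List (BagTree m) → ℕ → List ℕ → Maybe (BagTree m)
  subtreeAtChild []       k       p = nothing
  subtreeAtChild (t ∷ ts) zero    p = subtreeAt t p
  subtreeAtChild (t ∷ ts) (suc k) p = subtreeAtChild ts k p

mutual
  bagAt≡rootBag : ∀ {m} (t : BagTree m) p → bagAt t p ≡ Maybe.map rootBag (subtreeAt t p)
  bagAt≡rootBag (node b ts) []      = refl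
  bagAt≡rootBag (node b ts) (k ∷ p) = bagAtChild≡rootBag ts k p

  bagAtChild≡rootBag : ∀ {m} (ts : List (BagTree m)) k p →
    bagAtChild ts k p ≡ Maybe.map rootBag (subtreeAtChild ts k p)
  bagAtChild≡rootBag []       k       p = refl
  bagAtChild≡rootBag (t ∷ ts) zero    p = bagAt≡rootBag t p
  bagAtChild≡rootBag (t ∷ ts) (suc k) p = bagAtChild≡rootBag ts k p

mutual
  subtreeAt-++ : ∀ {m} (t : BagTree m) p q {t'} → subtreeAt t p ≡ just t' → subtreeAt t (p ++ q) ≡ subtreeAt t' q
  subtreeAt-++ t           []      q refl = refl
  subtreeAt-++ (node b ts) (k ∷ p) q eq   = subtreeAtChild-++ ts k p q eq

  subtreeAtChild-++ : ∀ {m} (ts : List (BagTree m)) k p q {t'} →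
    subtreeAtChild ts k p ≡ just t' → subtreeAtChild ts k (p ++ q) ≡ subtreeAt t' q
  subtreeAtChild-++ []       k       p q ()
  subtreeAtChild-++ (t ∷ ts) zero    p q eq = subtreeAt-++ t p q eq
  subtreeAtChild-++ (t ∷ ts) (suc k) p q eq = subtreeAtChild-++ ts k p q eq

subtreeAtChild⇒< : ∀ {m} (ts : List (BagTree m)) k p {t} → subtreeAtChild ts k p ≡ just t → k < length ts
subtreeAtChild⇒< []       k       p ()
subtreeAtChild⇒< (t ∷ ts) zero    p eq = s≤s z≤n
subtreeAtChild⇒< (t ∷ ts) (suc k) p eq = s≤s (subtreeAtChild⇒< ts k p eq)

InNode : ∀ {m} → BagTree m → Fin m → List ℕ → Set
InNode t i p = ∃₂ λ b ts → subtreeAt t p ≡ just (node b ts) × i ∈ₛ b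

InBag⇒InNode : ∀ {m} (t : BagTree m) i p → InBag i t p → InNode t i p
InBag⇒InNode t i p (b , eq , i∈b) with subtreeAt t p | bagAt≡rootBag t p
... | just (node b' ts) | eq' with refl ← trans (sym eq) eq' = b , ts , refl , i∈b
... | nothing           | eq' with () ← trans (sym eq) eq'

InNode⇒InBag : ∀ {m} (t : BagTree m) i p → InNode t i p → InBag i t p
InNode⇒InBag t i p (b , ts , eq , i∈b) = b , trans (bagAt≡rootBag t p) (cong (Maybe.map rootBag) eq) , i∈b

_≼?_ : (r p : List ℕ) → Dec (r ≼ p)
[]      ≼? p       = yes []≼
(a ∷ r) ≼? []      = no λ ()
(a ∷ r) ≼? (b ∷ p) with a ℕP.≟ b | r ≼? p
... | yes refl | yes r≼p = yes (∷≼ r≼p)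
... | yes refl | no r⋠p  = no λ { (∷≼ r≼p) → r⋠p r≼p }
... | no a≢b   | _       = no λ { (∷≼ _) → a≢b refl }

≼-refl : ∀ p → p ≼ p
≼-refl []      = []≼
≼-refl (a ∷ p) = ∷≼ (≼-refl p)

≼-++ : ∀ p q → p ≼ (p ++ q)
≼-++ []      q = []≼
≼-++ (a ∷ p) q = ∷≼ (≼-++ p q)

++-≼⇒≼ : ∀ p q r → (p ++ q) ≼ r → p ≼ r
++-≼⇒≼ []      q r         _          = []≼
++-≼⇒≼ (a ∷ p) q (.a ∷ r) (∷≼ pq≼r) = ∷≼ (++-≼⇒≼ p q r pq≼r)

≼⇒++ : ∀ p r → p ≼ r → ∃ λ q → r ≡ p ++ q
≼⇒++ []      r         _        = r , refl
≼⇒++ (a ∷ p) (.a ∷ r) (∷≼ p≼r) with q , refl ← ≼⇒++ p r p≼r = q , refl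

common-ancestor-≼ : ∀ p k s r₁ r₂ → s ≼ r₁ → (p ++ k ∷ []) ≼ r₁ → s ≼ r₂ → ¬ ((p ++ k ∷ []) ≼ r₂) → s ≼ p
common-ancestor-≼ p       k []      r₁ r₂ _ _ _ _ = []≼
common-ancestor-≼ []      k (a ∷ s) (.a ∷ r₁) (.a ∷ r₂) (∷≼ _) (∷≼ _) (∷≼ _) r₂⋠ = ⊥-elim (r₂⋠ (∷≼ []≼))
common-ancestor-≼ (b ∷ p) k (a ∷ s) (.a ∷ r₁) (.a ∷ r₂) (∷≼ s≼r₁) (∷≼ pk≼r₁) (∷≼ s≼r₂) r₂⋠ =
  ∷≼ (common-ancestor-≼ p k s r₁ r₂ s≼r₁ pk≼r₁ s≼r₂ (r₂⋠ ∘ ∷≼))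

child-≼-unique : ∀ p a b r → (p ++ a ∷ []) ≼ r → (p ++ b ∷ []) ≼ r → a ≡ b
child-≼-unique []      a b (.a ∷ r) (∷≼ _) (∷≼ _) = refl
child-≼-unique (c ∷ p) a b (.c ∷ r) (∷≼ pa≼r) (∷≼ pb≼r) = child-≼-unique p a b r pa≼r pb≼r

child-⋠ : ∀ p a → ¬ ((p ++ a ∷ []) ≼ p)
child-⋠ []      a ()
child-⋠ (c ∷ p) a (∷≼ pa≼p) = child-⋠ p a pa≼p

mutual
  occursIn : ∀ {m} → Fin m → BagTree m → Bool
  occursIn i (node b ts) = ⌊ i ∈? b ⌋ ∨ occursInAny i ts

  occursInAny : ∀ {m} → Fin m → List (BagTree m) → Bool
  occursInAny i []       = false
  occursInAny i (t ∷ ts) = occursIn i t ∨ occursInAny i ts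

mutual
  occursIn⇒ : ∀ {m} i (t : BagTree m) → occursIn i t ≡ true → ∃ λ q → InNode t i q
  occursIn⇒ i (node b ts) occ with i ∈? b
  ... | yes i∈b = [] , b , ts , refl , i∈b
  ... | no  _   with k , q , b' , ts' , eq , i∈b' ← occursInAny⇒ i ts occ = k ∷ q , b' , ts' , eq , i∈b'

  occursInAny⇒ : ∀ {m} i (ts : List (BagTree m)) → occursInAny i ts ≡ true →
    Σ ℕ λ k → Σ (List ℕ) λ q → ∃₂ λ b ts' → subtreeAtChild ts k q ≡ just (node b ts') × i ∈ₛ b
  occursInAny⇒ i []       ()
  occursInAny⇒ i (t ∷ ts) occ with Bool-cases (occursIn i t)
  ... | inj₁ occ-t = let q , b , ts' , eq , i∈b = occursIn⇒ i t occ-t in zero , q , b , ts' , eq , i∈b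
  ... | inj₂ ¬occ-t rewrite ¬occ-t =
    let k , q , b , ts' , eq , i∈b = occursInAny⇒ i ts occ in suc k , q , b , ts' , eq , i∈b

mutual
  ⇒occursIn : ∀ {m} i (t : BagTree m) q {b ts} → subtreeAt t q ≡ just (node b ts) → i ∈ₛ b → occursIn i t ≡ true
  ⇒occursIn i (node b ts) [] refl i∈b with i ∈? b
  ... | yes _   = refl
  ... | no i∉b  = ⊥-elim (i∉b i∈b)
  ⇒occursIn i (node b₀ ts₀) (k ∷ q) eq i∈b =
    trans (cong (⌊ i ∈? b₀ ⌋ ∨_) (⇒occursInAny i ts₀ k q eq i∈b)) (BoolP.∨-zeroʳ _)

  ⇒occursInAny : ∀ {m} i (ts : List (BagTree m)) k q {b ts'} →
    subtreeAtChild ts k q ≡ just (node b ts') → i ∈ₛ b → occursInAny i ts ≡ true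
  ⇒occursInAny i []       k       q ()
  ⇒occursInAny i (t ∷ ts) zero    q eq i∈b = cong (_∨ occursInAny i ts) (⇒occursIn i t q eq i∈b)
  ⇒occursInAny i (t ∷ ts) (suc k) q eq i∈b =
    trans (cong (occursIn i t ∨_) (⇒occursInAny i ts k q eq i∈b)) (BoolP.∨-zeroʳ _)

elements : ∀ {m} → Subset m → List (Fin m)
elements []          = []
elements (true ∷ p)  = zero ∷ map suc (elements p)
elements (false ∷ p) = map suc (elements p)

length-elements : ∀ {m} (p : Subset m) → length (elements p) ≡ ∣ p ∣
length-elements []          = refl
length-elements (true ∷ p)  = cong suc (trans (ListP.length-map suc (elements p)) (length-elements p))
length-elements (false ∷ p) = trans (ListP.length-map suc (elements p)) (length-elements p)

∈⇒∈elements : ∀ {m} {i : Fin m} (p : Subset m) → i ∈ₛ p → i ∈ elements p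
∈⇒∈elements (true ∷ p)  Vec.here      = here refl
∈⇒∈elements (true ∷ p)  (Vec.there i∈) = there (∈P.∈-map⁺ suc (∈⇒∈elements p i∈))
∈⇒∈elements (false ∷ p) (Vec.there i∈) = ∈P.∈-map⁺ suc (∈⇒∈elements p i∈)

∈ᵇ⇒∈ : ∀ {m} {i : Fin m} {b : Subset m} → ⌊ i ∈? b ⌋ ≡ true → i ∈ₛ b
∈ᵇ⇒∈ {i = i} {b} eq with i ∈? b
... | yes i∈b = i∈b

∈⇒∈ᵇ : ∀ {m} {i : Fin m} {b : Subset m} → i ∈ₛ b → ⌊ i ∈? b ⌋ ≡ true
∈⇒∈ᵇ {i = i} {b} i∈b with i ∈? b
... | yes _   = refl
... | no i∉b  = ⊥-elim (i∉b i∈b)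

∉ᵇ⇒∉ : ∀ {m} {i : Fin m} {b : Subset m} → ⌊ i ∈? b ⌋ ≡ false → ¬ i ∈ₛ b
∉ᵇ⇒∉ {i = i} {b} eq with i ∈? b
... | no i∉b = i∉b

-- Vtrees of bounded factor width from tree decompositions

memb⇒∈ : ∀ {Z : Set} (_≟ᶻ_ : DecidableEquality Z) z zs → memb _≟ᶻ_ z zs ≡ true → z ∈ zs
memb⇒∈ _≟ᶻ_ z []        ()
memb⇒∈ _≟ᶻ_ z (z' ∷ zs) z∈ with z ≟ᶻ z'
... | yes refl = here refl
... | no _     = there (memb⇒∈ _≟ᶻ_ z zs z∈)

∈⇒memb : ∀ {Z : Set} (_≟ᶻ_ : DecidableEquality Z) z zs → z ∈ zs → memb _≟ᶻ_ z zs ≡ true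
∈⇒memb _≟ᶻ_ z (z' ∷ zs) z∈ with z ≟ᶻ z'
... | yes _ = refl
∈⇒memb _≟ᶻ_ z (z' ∷ zs) (here refl) | no z≢z = ⊥-elim (z≢z refl)
∈⇒memb _≟ᶻ_ z (z' ∷ zs) (there z∈)  | no _    = ∈⇒memb _≟ᶻ_ z zs z∈

Everywhere : ∀ {A : Set} → (VTree A → Set) → VTree A → Set
Everywhere P t@(leaf _)  = P t
Everywhere P (un _)      = ⊥
Everywhere P t@(bin l r) = P t × Everywhere P l × Everywhere P r

Everywhere-root : ∀ {A : Set} {P : VTree A → Set} t → Everywhere P t → P t
Everywhere-root (leaf _)  Pt        = Pt
Everywhere-root (bin l r) (Pt , _) = Pt

leaves? : ∀ {A : Set} → Maybe (VTree A) → List A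
leaves? = Maybe.maybe leaves []

module FromTreeDecomposition {n : ℕ} (F : BF n) (C : Circuit n) (C⇒F : Computes C F)
  (w : ℕ) (D : TreeDecomp (Wire C) w) where

  open Circuit C renaming (size to m; gates to gs; output to out)
  open TreeDecomp D renaming (tree to t₀)

  M : ℕ
  M = 2 ^ ((w + 2) * 2 ^ (w + 1))

  Separation⇒factors≤ : ∀ {S} → Separation gs S w → length (factors F S) ≤ M
  Separation⇒factors≤ = SeparationBound.length-factors-≤ gs out F C⇒F

  private
    gateOf? : (x : Fin n) → Dec (∃ λ g → varOf gs g ≡ just x)
    gateOf? x = FinP.any? (λ g → MaybeP.≡-dec FinP._≟_ (varOf gs g) (just x))

  -- A node whose bag contains the input gate labelled x ([] if x labels no gate).
  home : Fin n → List ℕ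
  home x with gateOf? x
  ... | yes (g , _) = proj₁ (coverV g)
  ... | no _        = []

  home-exists : ∀ x → ∃ λ t → subtreeAt t₀ (home x) ≡ just t
  home-exists x with gateOf? x
  ... | no _        = t₀ , refl
  ... | yes (g , _) with b , ts , eq , _ ← InBag⇒InNode t₀ g _ (proj₂ (coverV g)) = node b ts , eq

  home-contains-gate : ∀ g x → varOf gs g ≡ just x → InNode t₀ g (home x)
  home-contains-gate g x g↦x with gateOf? x
  ... | no ∄g            = ⊥-elim (∄g (g , g↦x))
  ... | yes (g₀ , g₀↦x) with refl ← distinctVars g₀ g x g₀↦x g↦x = InBag⇒InNode t₀ g₀ _ (proj₂ (coverV g₀))

  BelowChild : List ℕ → ℕ → List (BagTree m) → Fin n → Set
  BelowChild p k ts' x = Σ ℕ λ j → j < length ts' × (p ++ (k + j) ∷ []) ≼ home x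

  module AtNode (p : List ℕ) {b : Subset m} {ts : List (BagTree m)} (p↦ : subtreeAt t₀ p ≡ just (node b ts)) where

    InNode⇒∈bag : ∀ {i} → InNode t₀ i p → i ∈ₛ b
    InNode⇒∈bag (b' , ts' , p↦' , i∈b') with refl ← trans (sym p↦) p↦' = i∈b'

    -- By connectedness, a gate outside the bag at p occurs below at most one child of p.
    stays-below-child : ∀ i → ¬ i ∈ₛ b → ∀ k r₁ r₂ →
      InNode t₀ i r₁ → (p ++ k ∷ []) ≼ r₁ → InNode t₀ i r₂ → (p ++ k ∷ []) ≼ r₂
    stays-below-child i i∉b k r₁ r₂ i-at-r₁ pk≼r₁ i-at-r₂ with (p ++ k ∷ []) ≼? r₂
    ... | yes pk≼r₂ = pk≼r₂
    ... | no  pk⋠r₂ = ⊥-elim (i∉b (InNode⇒∈bag (InBag⇒InNode t₀ i p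
          (connected i r₁ r₂ p (InNode⇒InBag t₀ i r₁ i-at-r₁) (InNode⇒InBag t₀ i r₂ i-at-r₂)
             (inj₁ (++-≼⇒≼ p (k ∷ []) r₁ pk≼r₁)) (λ s s≼r₁ s≼r₂ → common-ancestor-≼ p k s r₁ r₂ s≼r₁ pk≼r₁ s≼r₂ pk⋠r₂)))))

    length-elements-bag : length (elements b) ≤ suc w
    length-elements-bag =
      subst (_≤ suc w) (sym (length-elements b)) (narrow p b (trans (bagAt≡rootBag t₀ p) (cong (Maybe.map rootBag) p↦)))

    insideBag : Fin m → Bool
    insideBag i = ⌊ i ∈? b ⌋

    ownSeparation : (S : Fin n → Bool) → (∀ x → S x ≡ true → home x ≡ p) → Separation gs S w
    ownSeparation S S⇒home = record
      { sep = insideBag ; inner = λ _ → false ; sepList = elements b ; length-sepList = length-elements-bag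
      ; sep⇒∈sepList = λ i i∈b → ∈⇒∈elements b (∈ᵇ⇒∈ i∈b)
      ; inner⇒¬sep = λ _ ()
      ; input-of-inner = λ _ _ _ ()
      ; reads-inner = λ _ _ _ ()
      ; var∈S = λ g x kd≡ Sx _ → ∈⇒∈ᵇ (InNode⇒∈bag
          (subst (InNode t₀ g) (S⇒home x Sx) (home-contains-gate g x (kindOf⇒varOf gs g x kd≡))))
      ; var∉S = λ _ _ _ _ → refl }

    -- The variables homed below the children ts' of p (which start at index k), together with
    -- those homed at p itself if withOwn, are separated by the bag at p.
    module BelowChildren (withOwn : Bool) (k : ℕ) (ts' : List (BagTree m))
      (ts'↦ : ∀ j q → subtreeAtChild ts' j q ≡ subtreeAt t₀ (p ++ (k + j) ∷ q)) where

      Below : Fin n → Set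
      Below x = (withOwn ≡ true × home x ≡ p) ⊎ BelowChild p k ts' x

      inner : Fin m → Bool
      inner i = not (insideBag i) ∧ occursInAny i ts'

      inner⇒ : ∀ i → inner i ≡ true →
        ¬ i ∈ₛ b × Σ ℕ λ j → Σ (List ℕ) λ r → j < length ts' × (p ++ (k + j) ∷ []) ≼ r × InNode t₀ i r
      inner⇒ i i-inner with i ∈? b
      ... | no i∉b with j , q , b' , ts'' , j↦ , i∈b' ← occursInAny⇒ i ts' i-inner =
        i∉b , j , p ++ (k + j) ∷ q , subtreeAtChild⇒< ts' j q j↦ ,
        subst ((p ++ (k + j) ∷ []) ≼_) (ListP.++-assoc p ((k + j) ∷ []) q) (≼-++ (p ++ (k + j) ∷ []) q) ,
        b' , ts'' , trans (sym (ts'↦ j q)) j↦ , i∈b'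

      inner⇒outsideBag : ∀ i → inner i ≡ true → insideBag i ≡ false
      inner⇒outsideBag i i-inner with insideBag i
      inner⇒outsideBag i ()      | true
      ... | false = refl

      ⇒inner : ∀ i j r → ¬ i ∈ₛ b → j < length ts' → (p ++ (k + j) ∷ []) ≼ r → InNode t₀ i r → inner i ≡ true
      ⇒inner i j r i∉b _ pkj≼r (b' , ts'' , r↦ , i∈b') with ≼⇒++ (p ++ (k + j) ∷ []) r pkj≼r
      ... | q , refl with i ∈? b
      ...   | yes i∈b = ⊥-elim (i∉b i∈b)
      ...   | no _    = ⇒occursInAny i ts' j q
                          (trans (ts'↦ j q) (trans (cong (subtreeAt t₀) (sym (ListP.++-assoc p ((k + j) ∷ []) q))) r↦)) i∈b'

      -- A wire lies in some bag; if one end is inner, connectedness puts that bag below the same child.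
      wire-inner : ∀ i j → Wire C i j ⊎ Wire C j i → inner i ≡ true → insideBag j ≡ false → inner j ≡ true
      wire-inner i j wire i-inner j∉b with inner⇒ i i-inner
      ... | i∉b , c , r₁ , c< , pkc≼r₁ , i-at-r₁ =
        let r₂ , i∈r₂ , j∈r₂ = [ (λ ij → coverE i j ij) , (λ ji → let r , j∈ , i∈ = coverE j i ji in r , i∈ , j∈) ]′ wire in
        ⇒inner j c r₂ (∉ᵇ⇒∉ j∉b) c<
          (stays-below-child i i∉b (k + c) r₁ r₂ i-at-r₁ pkc≼r₁ (InBag⇒InNode t₀ i r₂ i∈r₂)) (InBag⇒InNode t₀ j r₂ j∈r₂)

      belowSeparation : (S : Fin n → Bool) → (∀ x → S x ≡ true → Below x) → (∀ x → Below x → S x ≡ true) →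
        Separation gs S w
      belowSeparation S S⇒below below⇒S = record
        { sep = insideBag ; inner = inner ; sepList = elements b ; length-sepList = length-elements-bag
        ; sep⇒∈sepList = λ i i∈b → ∈⇒∈elements b (∈ᵇ⇒∈ i∈b)
        ; inner⇒¬sep = inner⇒outsideBag
        ; input-of-inner = λ i j j∈ → wire-inner i j (inj₁ j∈)
        ; reads-inner = λ i j j∈ → wire-inner j i (inj₂ j∈)
        ; var∈S = var∈S
        ; var∉S = var∉S }
        where
        var∈S : ∀ g x → kindOf gs g ≡ kvar x → S x ≡ true → inner g ≡ false → insideBag g ≡ true
        var∈S g x kd≡ Sx g-outer with S⇒below x Sx | home-contains-gate g x (kindOf⇒varOf gs g x kd≡)
        ... | inj₁ (_ , home≡p)  | g-at-home = ∈⇒∈ᵇ (InNode⇒∈bag (subst (InNode t₀ g) home≡p g-at-home))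
        ... | inj₂ (j , j< , pkj≼) | g-at-home = [ (λ g∈b → g∈b) ,
              (λ g∉b → ⊥-elim (BoolP.not-¬ (⇒inner g j (home x) (∉ᵇ⇒∉ g∉b) j< pkj≼ g-at-home) g-outer)) ]′
              (Bool-cases (insideBag g))
        var∉S : ∀ g x → kindOf gs g ≡ kvar x → S x ≡ false → inner g ≡ false
        var∉S g x kd≡ ¬Sx = contraposeᵇ g-inner⇒Sx ¬Sx
          where
          g-inner⇒Sx : inner g ≡ true → S x ≡ true
          g-inner⇒Sx g-inner with g∉b , j , r , j< , pkj≼r , g-at-r ← inner⇒ g g-inner =
            below⇒S x (inj₂ (j , j< , stays-below-child g g∉b (k + j) r (home x) g-at-r pkj≼r
                                        (home-contains-gate g x (kindOf⇒varOf gs g x kd≡))))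

  FactorsBounded : VTree (ZVar n 0) → Set
  FactorsBounded T = length (factors F (varsBelow zeq inj₁ T)) ≤ M

  fwT≤M : ∀ T → Everywhere FactorsBounded T → fwT zeq inj₁ F T ≤ M
  fwT≤M (leaf _)  bounded          = bounded
  fwT≤M (bin l r) (bounded , l≤ , r≤) = ℕP.⊔-lub (ℕP.⊔-lub bounded (fwT≤M l l≤)) (fwT≤M r r≤)

  record PartialVTree (Y : Fin n → Set) : Set where
    constructor partial
    field
      tree     : Maybe (VTree (ZVar n 0))
      sound    : ∀ x → inj₁ x ∈ leaves? tree → Y x
      complete : ∀ x → Y x → inj₁ x ∈ leaves? tree
      unique   : Unique (leaves? tree)
      bounded  : MaybeAll.All (Everywhere FactorsBounded) tree

  Separable : (Fin n → Set) → Set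
  Separable Y = ∀ S → (∀ x → S x ≡ true → Y x) → (∀ x → Y x → S x ≡ true) → Separation gs S w

  private
    bounded-root : ∀ {Y} T → Separable Y → (∀ x → inj₁ x ∈ leaves T → Y x) → (∀ x → Y x → inj₁ x ∈ leaves T) →
      FactorsBounded T
    bounded-root T sep-Y sound complete = Separation⇒factors≤ (sep-Y (varsBelow zeq inj₁ T)
      (λ x x∈ → sound x (memb⇒∈ zeq (inj₁ x) (leaves T) x∈)) (λ x Yx → ∈⇒memb zeq (inj₁ x) (leaves T) (complete x Yx)))

  join : ∀ {Y Y₁ Y₂} → PartialVTree Y₁ → PartialVTree Y₂ →
    (∀ x → Y x → Y₁ x ⊎ Y₂ x) → (∀ x → Y₁ x → Y x) → (∀ x → Y₂ x → Y x) → (∀ x → Y₁ x → Y₂ x → ⊥) →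
    Separable Y → PartialVTree Y
  join (partial nothing _ c₁ _ _) (partial t₂ s₂ c₂ u₂ b₂) split Y₁⇒ Y₂⇒ _ _ =
    partial t₂ (λ x x∈ → Y₂⇒ x (s₂ x x∈)) (λ x Yx → [ (λ Y₁x → ⊥-elim (∉[] (c₁ x Y₁x))) , c₂ x ]′ (split x Yx)) u₂ b₂
    where ∉[] : ∀ {z : ZVar n 0} → ¬ z ∈ [] ; ∉[] ()
  join (partial (just l) s₁ c₁ u₁ b₁) (partial nothing _ c₂ _ _) split Y₁⇒ Y₂⇒ _ _ =
    partial (just l) (λ x x∈ → Y₁⇒ x (s₁ x x∈)) (λ x Yx → [ c₁ x , (λ Y₂x → ⊥-elim (∉[] (c₂ x Y₂x))) ]′ (split x Yx)) u₁ b₁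
    where ∉[] : ∀ {z : ZVar n 0} → ¬ z ∈ [] ; ∉[] ()
  join {Y} (partial (just l) s₁ c₁ u₁ (MaybeAll.just b₁)) (partial (just r) s₂ c₂ u₂ (MaybeAll.just b₂))
       split Y₁⇒ Y₂⇒ disjoint sep-Y =
    partial (just (bin l r)) sound complete (UniqueP.++⁺ u₁ u₂ leaves-disjoint)
      (MaybeAll.just (bounded-root (bin l r) sep-Y sound complete , b₁ , b₂))
    where
    sound : ∀ x → inj₁ x ∈ leaves l ++ leaves r → Y x
    sound x x∈ = [ (λ x∈l → Y₁⇒ x (s₁ x x∈l)) , (λ x∈r → Y₂⇒ x (s₂ x x∈r)) ]′ (∈P.∈-++⁻ (leaves l) x∈)
    complete : ∀ x → Y x → inj₁ x ∈ leaves l ++ leaves r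
    complete x Yx = [ (λ Y₁x → ∈P.∈-++⁺ˡ (c₁ x Y₁x)) , (λ Y₂x → ∈P.∈-++⁺ʳ (leaves l) (c₂ x Y₂x)) ]′ (split x Yx)
    leaves-disjoint : ∀ {z} → ¬ (z ∈ leaves l × z ∈ leaves r)
    leaves-disjoint {inj₁ x} (x∈l , x∈r) = disjoint x (s₁ x x∈l) (s₂ x x∈r)

  singleton : ∀ x → Separable (_≡ x) → PartialVTree (_≡ x)
  singleton x sep-x =
    partial (just (leaf (inj₁ x))) sound (λ { y refl → here refl }) ([] ∷ [])
      (MaybeAll.just (bounded-root (leaf (inj₁ x)) sep-x sound (λ { y refl → here refl })))
    where
    sound : ∀ y → inj₁ y ∈ inj₁ x ∷ [] → y ≡ x
    sound y (here refl) = refl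

  ownVTree : ∀ p {b ts} → subtreeAt t₀ p ≡ just (node b ts) → (xs : List (Fin n)) → (∀ x → x ∈ xs → home x ≡ p) →
    Unique xs → PartialVTree (_∈ xs)
  ownVTree p p↦ []       _        _            = partial nothing (λ _ ()) (λ _ ()) [] MaybeAll.nothing
  ownVTree p p↦ (x ∷ xs) xs⇒home (x∉xs ∷ xs!) =
    join (singleton x (λ S S⇒ _ → ownSeparation S (λ y Sy → xs⇒home y (here (S⇒ y Sy)))))
         (ownVTree p p↦ xs (λ y y∈ → xs⇒home y (there y∈)) xs!)
         split (λ y → here) (λ y → there) (λ { y refl y∈xs → All.lookup x∉xs y∈xs refl })
         (λ S S⇒ _ → ownSeparation S (λ y Sy → xs⇒home y (S⇒ y Sy)))
    where
    open AtNode p p↦ using (ownSeparation)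
    split : ∀ y → y ∈ x ∷ xs → y ≡ x ⊎ y ∈ xs
    split y (here y≡x) = inj₁ y≡x
    split y (there y∈) = inj₂ y∈

  homedAt : List ℕ → List (Fin n)
  homedAt p = filter (λ x → ListP.≡-dec ℕP._≟_ (home x) p) (allFin n)

  homedAt⇒home : ∀ p x → x ∈ homedAt p → home x ≡ p
  homedAt⇒home p x x∈ = proj₂ (∈P.∈-filter⁻ (λ x → ListP.≡-dec ℕP._≟_ (home x) p) {xs = allFin n} x∈)

  home⇒homedAt : ∀ p x → home x ≡ p → x ∈ homedAt p
  home⇒homedAt p x = ∈P.∈-filter⁺ (λ x → ListP.≡-dec ℕP._≟_ (home x) p) (∈P.∈-allFin x)

  homedAt-unique : ∀ p → Unique (homedAt p)
  homedAt-unique p = UniqueP.filter⁺ (λ x → ListP.≡-dec ℕP._≟_ (home x) p) (UniqueP.allFin⁺ n)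

  mutual
    nodeVTree : ∀ p t → subtreeAt t₀ p ≡ just t → PartialVTree (λ x → p ≼ home x)
    nodeVTree p (node b ts) p↦ =
      join (ownVTree p p↦ (homedAt p) (homedAt⇒home p) (homedAt-unique p)) (childrenVTree p p↦ 0 ts ts↦)
           split homed⇒ below-child⇒ disjoint separable
      where
      open AtNode p p↦
      ts↦ : ∀ j q → subtreeAtChild ts j q ≡ subtreeAt t₀ (p ++ j ∷ q)
      ts↦ j q = sym (subtreeAt-++ t₀ p (j ∷ q) p↦)
      homed⇒ : ∀ x → x ∈ homedAt p → p ≼ home x
      homed⇒ x x∈ = subst (p ≼_) (sym (homedAt⇒home p x x∈)) (≼-refl p)
      below-child⇒ : ∀ x → BelowChild p 0 ts x → p ≼ home x
      below-child⇒ x (j , _ , pj≼) = ++-≼⇒≼ p (j ∷ []) (home x) pj≼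
      split : ∀ x → p ≼ home x → x ∈ homedAt p ⊎ BelowChild p 0 ts x
      split x p≼ with ≼⇒++ p (home x) p≼
      ... | []    , eq = inj₁ (home⇒homedAt p x (trans eq (ListP.++-identityʳ p)))
      ... | j ∷ q , eq = inj₂ (j , j< , pj≼)
        where
        j< : j < length ts
        j< with t , home↦ ← home-exists x =
          subtreeAtChild⇒< ts j q (trans (ts↦ j q) (trans (cong (subtreeAt t₀) (sym eq)) home↦))
        pj≼ : (p ++ j ∷ []) ≼ home x
        pj≼ = subst ((p ++ j ∷ []) ≼_) (trans (ListP.++-assoc p (j ∷ []) q) (sym eq)) (≼-++ (p ++ j ∷ []) q)
      disjoint : ∀ x → x ∈ homedAt p → BelowChild p 0 ts x → ⊥
      disjoint x x∈ (j , _ , pj≼) = child-⋠ p j (subst ((p ++ j ∷ []) ≼_) (homedAt⇒home p x x∈) pj≼)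
      separable : Separable (λ x → p ≼ home x)
      separable S S⇒ ⇒S = BelowChildren.belowSeparation true 0 ts ts↦ S
        (λ x Sx → [ (λ x∈ → inj₁ (refl , homedAt⇒home p x x∈)) , inj₂ ]′ (split x (S⇒ x Sx)))
        (λ x below → ⇒S x ([ (λ (_ , home≡p) → subst (p ≼_) (sym home≡p) (≼-refl p)) , below-child⇒ x ]′ below))

    childrenVTree : ∀ p {b ts} → subtreeAt t₀ p ≡ just (node b ts) → ∀ k ts' →
      (∀ j q → subtreeAtChild ts' j q ≡ subtreeAt t₀ (p ++ (k + j) ∷ q)) → PartialVTree (BelowChild p k ts')
    childrenVTree p p↦ k []        _    = partial nothing (λ _ ()) (λ { x (j , () , _) }) [] MaybeAll.nothing
    childrenVTree p p↦ k (t ∷ ts') ts'↦ =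
      join (nodeVTree (p ++ k ∷ []) t t↦) (childrenVTree p p↦ (suc k) ts' ts'↦-suc)
           split first⇒ rest⇒ disjoint separable
      where
      open AtNode p p↦
      t↦ : subtreeAt t₀ (p ++ k ∷ []) ≡ just t
      t↦ = subst (λ z → subtreeAt t₀ (p ++ z ∷ []) ≡ just t) (ℕP.+-identityʳ k) (sym (ts'↦ 0 []))
      ts'↦-suc : ∀ j q → subtreeAtChild ts' j q ≡ subtreeAt t₀ (p ++ (suc k + j) ∷ q)
      ts'↦-suc j q = trans (ts'↦ (suc j) q) (cong (λ z → subtreeAt t₀ (p ++ z ∷ q)) (ℕP.+-suc k j))
      split : ∀ x → BelowChild p k (t ∷ ts') x → (p ++ k ∷ []) ≼ home x ⊎ BelowChild p (suc k) ts' x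
      split x (zero  , _       , pk≼)  = inj₁ (subst (λ z → (p ++ z ∷ []) ≼ home x) (ℕP.+-identityʳ k) pk≼)
      split x (suc j , s≤s j< , pkj≼) = inj₂ (j , j< , subst (λ z → (p ++ z ∷ []) ≼ home x) (ℕP.+-suc k j) pkj≼)
      first⇒ : ∀ x → (p ++ k ∷ []) ≼ home x → BelowChild p k (t ∷ ts') x
      first⇒ x pk≼ = zero , s≤s z≤n , subst (λ z → (p ++ z ∷ []) ≼ home x) (sym (ℕP.+-identityʳ k)) pk≼
      rest⇒ : ∀ x → BelowChild p (suc k) ts' x → BelowChild p k (t ∷ ts') x
      rest⇒ x (j , j< , pkj≼) = suc j , s≤s j< , subst (λ z → (p ++ z ∷ []) ≼ home x) (sym (ℕP.+-suc k j)) pkj≼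
      disjoint : ∀ x → (p ++ k ∷ []) ≼ home x → BelowChild p (suc k) ts' x → ⊥
      disjoint x pk≼ (j , _ , pkj≼) = ℕP.m≢1+m+n k (child-≼-unique p k (suc k + j) (home x) pk≼ pkj≼)
      separable : Separable (BelowChild p k (t ∷ ts'))
      separable S S⇒ ⇒S = BelowChildren.belowSeparation false k (t ∷ ts') ts'↦ S
        (λ x Sx → inj₂ (S⇒ x Sx)) (λ x → ⇒S x ∘ [ (λ { (() , _) }) , (λ below → below) ]′)

  -- The variable x₀ rules out the empty vtree.
  bounded-vtree : Fin n → Σ (VTree (ZVar n 0)) λ T → IsVTreeFor T × fwT zeq inj₁ F T ≤ M
  bounded-vtree x₀ with nodeVTree [] t₀ refl
  ... | partial nothing  _ complete _      _                      with () ← complete x₀ []≼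
  ... | partial (just T) _ complete unique (MaybeAll.just bounded) = T , (unique , covers) , fwT≤M T bounded
    where
    covers : (z : ZVar n 0) → z ∈ leaves T
    covers (inj₁ x) = complete x []≼

-- Restricting a vtree to X

module _ {X K : Set} (key : X → K) (_≟ᴷ_ : DecidableEquality K) where

  map-deduplicate-on : ∀ xs →
    map key (deduplicate (λ x y → key x ≟ᴷ key y) xs) ≡ deduplicate _≟ᴷ_ (map key xs)
  map-deduplicate-on []       = refl
  map-deduplicate-on (x ∷ xs) = cong (key x ∷_) (begin
    map key (filter (λ y → ¬? (key x ≟ᴷ key y)) (deduplicate _ xs))  ≡⟨ map-filter (deduplicate _ xs) ⟩
    filter (λ k → ¬? (key x ≟ᴷ k)) (map key (deduplicate _ xs))      ≡⟨ cong (filter _) (map-deduplicate-on xs) ⟩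
    filter (λ k → ¬? (key x ≟ᴷ k)) (deduplicate _≟ᴷ_ (map key xs))   ∎)
    where
    open ≡-Reasoning
    map-filter : ∀ ys → map key (filter (λ y → ¬? (key x ≟ᴷ key y)) ys) ≡ filter (λ k → ¬? (key x ≟ᴷ k)) (map key ys)
    map-filter []       = refl
    map-filter (y ∷ ys) with key x ≟ᴷ key y
    ... | yes _ = map-filter ys
    ... | no  _ = cong (key y ∷_) (map-filter ys)

  length-deduplicate-on : ∀ xs ys → map key xs ≡ map key ys →
    length (deduplicate (λ x y → key x ≟ᴷ key y) xs) ≡ length (deduplicate (λ x y → key x ≟ᴷ key y) ys)
  length-deduplicate-on xs ys eq = begin
    length (deduplicate _ xs)               ≡⟨ sym (ListP.length-map key (deduplicate _ xs)) ⟩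
    length (map key (deduplicate _ xs))     ≡⟨ cong length (map-deduplicate-on xs) ⟩
    length (deduplicate _≟ᴷ_ (map key xs))  ≡⟨ cong (length ∘ deduplicate _≟ᴷ_) eq ⟩
    length (deduplicate _≟ᴷ_ (map key ys))  ≡⟨ cong length (sym (map-deduplicate-on ys)) ⟩
    length (map key (deduplicate _ ys))     ≡⟨ ListP.length-map key (deduplicate _ ys) ⟩
    length (deduplicate _ ys)               ∎
    where open ≡-Reasoning

length-factors-cong : ∀ {n} (F : BF n) → (∀ a a' → (∀ x → a x ≡ a' x) → F a ≡ F a') →
  ∀ S S' → (∀ x → S x ≡ S' x) → length (factors F S) ≡ length (factors F S')
length-factors-cong {n} F F-ext S S' S≗S' =
  length-deduplicate-on table (ListP.≡-dec BoolP._≟_) _ _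
    (sym (ListP.map-∘ (allAssign n)) ⟨ trans ⟩ ListP.map-cong same-table (allAssign n) ⟨ trans ⟩ ListP.map-∘ (allAssign n))
  where
  same-cofactor : ∀ b → table (cofactor F S b) ≡ table (cofactor F S' b)
  same-cofactor b = ListP.map-cong (λ a → F-ext _ _ (λ x → cong (λ s → if s then b x else a x) (S≗S' x))) (allAssign n)
  same-table : ∀ b → table (factorOf F S b) ≡ table (factorOf F S' b)
  same-table b = ListP.map-cong
    (λ c → cong₂ (λ t u → ⌊ ListP.≡-dec BoolP._≟_ t u ⌋) (same-cofactor c) (same-cofactor b)) (allAssign n)

memb-cong : ∀ {A B : Set} (_≟ᴬ_ : DecidableEquality A) (_≟ᴮ_ : DecidableEquality B) (f : A → B) xs zs →
  (∀ y → y ∈ xs → f y ∈ zs) → (∀ y → f y ∈ zs → y ∈ xs) → ∀ y → memb _≟ᴬ_ y xs ≡ memb _≟ᴮ_ (f y) zs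
memb-cong _≟ᴬ_ _≟ᴮ_ f xs zs ⊆zs ⊆xs y with Bool-cases (memb _≟ᴬ_ y xs) | Bool-cases (memb _≟ᴮ_ (f y) zs)
... | inj₁ y∈  | inj₁ fy∈  = trans y∈ (sym fy∈)
... | inj₂ y∉  | inj₂ fy∉  = trans y∉ (sym fy∉)
... | inj₁ y∈  | inj₂ fy∉  = ⊥-elim (BoolP.not-¬ (∈⇒memb _≟ᴮ_ (f y) zs (⊆zs y (memb⇒∈ _≟ᴬ_ y xs y∈))) fy∉)
... | inj₂ y∉  | inj₁ fy∈  = ⊥-elim (BoolP.not-¬ (∈⇒memb _≟ᴬ_ y xs (⊆xs y (memb⇒∈ _≟ᴮ_ (f y) zs fy∈))) y∉)

Everywhere⇒Full : ∀ {A : Set} {P : VTree A → Set} t → Everywhere P t → Full t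
Everywhere⇒Full (leaf _)  _              = tt
Everywhere⇒Full (bin l r) (_ , Pl , Pr) = Everywhere⇒Full l Pl , Everywhere⇒Full r Pr

binMaybe : ∀ {A : Set} → Maybe (VTree A) → Maybe (VTree A) → Maybe (VTree A)
binMaybe nothing  r        = r
binMaybe (just l) nothing  = just l
binMaybe (just l) (just r) = just (bin l r)

leaves?-binMaybe : ∀ {A : Set} (l r : Maybe (VTree A)) → leaves? (binMaybe l r) ≡ leaves? l ++ leaves? r
leaves?-binMaybe nothing  r        = refl
leaves?-binMaybe (just l) nothing  = sym (ListP.++-identityʳ (leaves l))
leaves?-binMaybe (just l) (just r) = refl

restrict : ∀ {n e} → VTree (ZVar n e) → Maybe (VTree (Fin n))
restrict (leaf (inj₁ x)) = just (leaf x)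
restrict (leaf (inj₂ _)) = nothing
restrict (un t)          = restrict t
restrict (bin l r)       = binMaybe (restrict l) (restrict r)

∈-restrict⁻ : ∀ {n e} (t : VTree (ZVar n e)) x → x ∈ leaves? (restrict t) → inj₁ x ∈ leaves t
∈-restrict⁻ (leaf (inj₁ _)) x (here refl) = here refl
∈-restrict⁻ (un t)          x x∈         = ∈-restrict⁻ t x x∈
∈-restrict⁻ (bin l r)       x x∈
  with ∈P.∈-++⁻ (leaves? (restrict l)) (subst (x ∈_) (leaves?-binMaybe (restrict l) (restrict r)) x∈)
... | inj₁ x∈l = ∈P.∈-++⁺ˡ (∈-restrict⁻ l x x∈l)
... | inj₂ x∈r = ∈P.∈-++⁺ʳ (leaves l) (∈-restrict⁻ r x x∈r)

∈-restrict⁺ : ∀ {n e} (t : VTree (ZVar n e)) x → inj₁ x ∈ leaves t → x ∈ leaves? (restrict t)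
∈-restrict⁺ (leaf (inj₁ _)) x (here refl) = here refl
∈-restrict⁺ (un t)          x x∈         = ∈-restrict⁺ t x x∈
∈-restrict⁺ (bin l r)       x x∈ =
  subst (x ∈_) (sym (leaves?-binMaybe (restrict l) (restrict r)))
    ([ (λ x∈l → ∈P.∈-++⁺ˡ (∈-restrict⁺ l x x∈l)) , (λ x∈r → ∈P.∈-++⁺ʳ (leaves? (restrict l)) (∈-restrict⁺ r x x∈r)) ]′
      (∈P.∈-++⁻ (leaves l) x∈))

restrict-Unique : ∀ {n e} (t : VTree (ZVar n e)) → Unique (leaves t) → Unique (leaves? (restrict t))
restrict-Unique (leaf (inj₁ x)) _ = [] ∷ []
restrict-Unique (leaf (inj₂ _)) _ = []
restrict-Unique (un t)          t! = restrict-Unique t t!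
restrict-Unique (bin l r)       lr! =
  let l! , r! , disjoint = Unique-++⁻ (leaves l) (leaves r) lr! in
  subst Unique (sym (leaves?-binMaybe (restrict l) (restrict r)))
    (UniqueP.++⁺ (restrict-Unique l l!) (restrict-Unique r r!)
      (λ (x∈l , x∈r) → disjoint (∈-restrict⁻ l _ x∈l) (∈-restrict⁻ r _ x∈r)))

varsBelow-restrict : ∀ {n e} (t : VTree (ZVar n e)) {t'} → restrict t ≡ just t' →
  ∀ x → varsBelow FinP._≟_ (λ y → y) t' x ≡ varsBelow zeq inj₁ t x
varsBelow-restrict t t↦t' = memb-cong FinP._≟_ zeq inj₁ _ (leaves t)
  (λ y y∈ → ∈-restrict⁻ t y (subst (λ u → y ∈ leaves? u) (sym t↦t') y∈))
  (λ y y∈ → subst (λ u → y ∈ leaves? u) t↦t' (∈-restrict⁺ t y y∈))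

module _ {n e : ℕ} (F : BF n) where

  factors≤fwT : ∀ (t : VTree (ZVar n e)) → length (factors F (varsBelow zeq inj₁ t)) ≤ fwT zeq inj₁ F t
  factors≤fwT (leaf _)  = ℕP.≤-refl
  factors≤fwT (un t)    = ℕP.m≤m⊔n _ _
  factors≤fwT (bin l r) = ℕP.≤-trans (ℕP.m≤m⊔n _ _) (ℕP.m≤m⊔n _ _)

  fwT-un : ∀ (t : VTree (ZVar n e)) → fwT zeq inj₁ F t ≤ fwT zeq inj₁ F (un t)
  fwT-un t = ℕP.m≤n⊔m _ _

  fwT-binˡ : ∀ (l r : VTree (ZVar n e)) → fwT zeq inj₁ F l ≤ fwT zeq inj₁ F (bin l r)
  fwT-binˡ l r = ℕP.≤-trans (ℕP.m≤n⊔m (length (factors F (varsBelow zeq inj₁ (bin l r)))) _) (ℕP.m≤m⊔n _ _)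

  fwT-binʳ : ∀ (l r : VTree (ZVar n e)) → fwT zeq inj₁ F r ≤ fwT zeq inj₁ F (bin l r)
  fwT-binʳ l r = ℕP.m≤n⊔m _ _

length-andGatesAt : ∀ {n} (F : BF n) l r Hs →
  length (andGatesAt F l r Hs) ≤ length (factors F (Xv F l)) * length (factors F (Xv F r))
length-andGatesAt {n} F l r Hs =
  ℕP.≤-trans (Unique⇒length≤ _ pairs gates! (All.tabulate gate∈pairs))
             (ℕP.≤-reflexive (length-cartesianProduct (factors F (Xv F l)) (factors F (Xv F r))))
  where
  pairs : List (BF n × BF n)
  pairs = cartesianProduct (factors F (Xv F l)) (factors F (Xv F r))
  candidates : List (BF n × BF n)
  candidates = concatMap (λ H → impl F H (Xv F l) (Xv F r)) Hs
  gates! : Unique (andGatesAt F l r Hs)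
  gates! = AllPairs.map (λ ¬same eq → ¬same (subst (λ q → SameFn _ (proj₁ q) × SameFn _ (proj₂ q)) eq (refl , refl)))
                        (deduplicate-AllPairs sameFn2? candidates)
  gate∈pairs : ∀ {g} → g ∈ andGatesAt F l r Hs → g ∈ pairs
  gate∈pairs g∈ with H , g∈impl ← Any.satisfied (∈P.∈-concatMap⁻ (λ H → impl F H (Xv F l) (Xv F r)) {xs = Hs}
                                     (∈P.∈-deduplicate⁻ sameFn2? candidates g∈)) =
    proj₁ (∈P.∈-filter⁻ (λ q → T? (implies (Xv F l) (proj₁ q) (proj₂ q) H)) {xs = pairs} g∈impl)

module FiwBound {n : ℕ} (F : BF n) (F-ext : ∀ a a' → (∀ x → a x ≡ a' x) → F a ≡ F a') (k : ℕ) where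

  NodeBounded : VTree (Fin n) → Set
  NodeBounded v = length (factors F (Xv F v)) ≤ k

  node-bounded : ∀ {e} (t : VTree (ZVar n e)) {t'} → restrict t ≡ just t' → fwT zeq inj₁ F t ≤ k → NodeBounded t'
  node-bounded t t↦t' fw≤ =
    ℕP.≤-trans (ℕP.≤-reflexive (length-factors-cong F F-ext _ _ (varsBelow-restrict t t↦t')))
               (ℕP.≤-trans (factors≤fwT F t) fw≤)

  restrict-bounded : ∀ {e} (t : VTree (ZVar n e)) → fwT zeq inj₁ F t ≤ k →
    MaybeAll.All (Everywhere NodeBounded) (restrict t)
  restrict-bounded (leaf (inj₁ x)) fw≤ = MaybeAll.just (node-bounded (leaf (inj₁ x)) refl fw≤)
  restrict-bounded (leaf (inj₂ _)) _   = MaybeAll.nothing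
  restrict-bounded (un t)          fw≤ = restrict-bounded t (ℕP.≤-trans (fwT-un F t) fw≤)
  restrict-bounded (bin l r)       fw≤ =
    binMaybe-bounded (restrict l) (restrict r) refl refl
      (restrict-bounded l (ℕP.≤-trans (fwT-binˡ F l r) fw≤)) (restrict-bounded r (ℕP.≤-trans (fwT-binʳ F l r) fw≤))
    where
    binMaybe-bounded : ∀ l' r' → restrict l ≡ l' → restrict r ≡ r' →
      MaybeAll.All (Everywhere NodeBounded) l' → MaybeAll.All (Everywhere NodeBounded) r' →
      MaybeAll.All (Everywhere NodeBounded) (binMaybe l' r')
    binMaybe-bounded nothing   r'        _    _    _                   r'≤ = r'≤
    binMaybe-bounded (just l') nothing   _    _    l'≤                 _   = l'≤
    binMaybe-bounded (just l') (just r') l↦l' r↦r' (MaybeAll.just l'≤) (MaybeAll.just r'≤) =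
      MaybeAll.just (node-bounded (bin l r) (cong₂ binMaybe l↦l' r↦r') fw≤ , l'≤ , r'≤)

  fiwGo≤ : ∀ T Hs → Everywhere NodeBounded T → fiwGo F T Hs ≤ k * k
  fiwGo≤ (leaf _)  Hs _               = z≤n
  fiwGo≤ (bin l r) Hs (_ , l≤ , r≤) =
    ℕP.⊔-lub (ℕP.⊔-lub (ℕP.≤-trans (length-andGatesAt F l r Hs) (ℕP.*-mono-≤ (Everywhere-root l l≤) (Everywhere-root r r≤)))
                       (fiwGo≤ l _ l≤))
             (fiwGo≤ r _ r≤)

  restricted-vtree : ∀ {e} (T : VTree (ZVar n e)) → IsVTreeFor T → fwT zeq inj₁ F T ≤ k → Fin n →
    Σ (VTree (Fin n)) λ T' → IsVTreeFor T' × Full T' × fiwT F T' ≤ k * k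
  restricted-vtree T (T! , covers) fw≤ x₀
    with restrict T | ∈-restrict⁺ T x₀ (covers (inj₁ x₀)) | restrict-Unique T T! | restrict-bounded T fw≤
       | (λ x → ∈-restrict⁺ T x (covers (inj₁ x)))
  ... | just T' | _ | T'! | MaybeAll.just bounded | covers' =
    T' , (T'! , covers') , Everywhere⇒Full T' bounded , fiwGo≤ T' (F ∷ []) bounded

firstLeaf : ∀ {A : Set} → VTree A → A
firstLeaf (leaf x)  = x
firstLeaf (un t)    = firstLeaf t
firstLeaf (bin l _) = firstLeaf l

square-bound : ∀ c → 2 ^ ((c + 2) * 2 ^ (c + 1)) * 2 ^ ((c + 2) * 2 ^ (c + 1)) ≡ 2 ^ ((c + 2) * 2 ^ (c + 2))
square-bound c = begin
  2 ^ ((c + 2) * 2 ^ (c + 1)) * 2 ^ ((c + 2) * 2 ^ (c + 1))  ≡⟨ ℕP.^-distribˡ-+-* 2 X X ⟨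
  2 ^ ((c + 2) * 2 ^ (c + 1) + (c + 2) * 2 ^ (c + 1))        ≡⟨ cong (2 ^_) (double (c + 2) (2 ^ (c + 1))) ⟩
  2 ^ ((c + 2) * (2 * 2 ^ (c + 1)))                          ≡⟨ cong (λ e → 2 ^ ((c + 2) * 2 ^ e)) (ℕP.+-suc c 1) ⟨
  2 ^ ((c + 2) * 2 ^ (c + 2))                                ∎
  where
  open ≡-Reasoning
  X : ℕ
  X = (c + 2) * 2 ^ (c + 1)
  double : ∀ z y → z * y + z * y ≡ z * (2 * y)
  double = solve-∀

mainTheorem7 : (n : ℕ) (F : BF n) (a b c : ℕ) →
    IsFiw F a → IsFw F b → IsCtw F c →
    a ≤ b * b × b * b ≤ 2 ^ ((c + 2) * 2 ^ (c + 2))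
mainTheorem7 n F a b c ((T₀ , _) , fiw-minimal) ((e , T , T-vtree , fw≡b) , fw-minimal) ((C , C⇒F , D) , _)
  -- a vtree has a leaf, so X is nonempty
  with T' , T'-vtree , T'-full , fiw≤b*b ←
         FiwBound.restricted-vtree F (Computes⇒ext {C = C} C⇒F) b T T-vtree (ℕP.≤-reflexive fw≡b) (firstLeaf T₀)
     | T″ , T″-vtree , fw≤M ← FromTreeDecomposition.bounded-vtree F C C⇒F c D (firstLeaf T₀) =
  let b≤M = ℕP.≤-trans (fw-minimal 0 T″ T″-vtree) fw≤M in
  ℕP.≤-trans (fiw-minimal T' T'-vtree T'-full) fiw≤b*b ,
  ℕP.≤-trans (ℕP.*-mono-≤ b≤M b≤M) (ℕP.≤-reflexive (square-bound c))
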